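{- For any integers $k,\ell,t\geqslant 2$ and any positive integer $m<\ell$, setting $r=(k-1)\ell+m$, there exists a Cayley graph that has diameter $k$, degree $2t^\ell + (2r-3)t^m - r$, and order $r\,t^r$.
   Context: For a group $G$ and a subset $S\subseteq G$ not containing the identity with $S=S^{ -1}$, the Cayley graph of $G$ generated by $S$ is the undirected simple graph with vertex set $G$ in which $g$ and $gs$ are adjacent for all $g\in G$, $s\in S$; it is regular of degree $|S|$ and has order $|G|$. -}

module Defs where

open import Level using (0ℓ)
open import Data.Nat using (ℕ; zero; suc; _∸_)
open import Data.Fin using (Fin)
open import Data.List using (List; length)
open import Data.List.Relation.Unary.AllPairs using (AllPairs)
open import Data.Product using (_×_; ∃-syntax)
open import Relation.Nullary using (¬_)
open import Relation.Binary.PropositionalEquality as ≡ using (_≡_)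
open import Function.Bundles using (Inverse)
open import Algebra.Bundles using (Group)
import Data.List.Membership.Setoid as SetoidMembership

-- A Cayley graph Cay(G,S): a group G (equality is the group's setoid
-- equality) together with a generating list S of pairwise distinct
-- elements (so |S| = length S), with identity ∉ S and S = S⁻¹.
record CayleyGraph : Set₁ where
  field
    G : Group 0ℓ 0ℓ
  open Group G public
  open SetoidMembership setoid public using (_∈_)
  field
    S          : List Carrier
    S-distinct : AllPairs (λ a b → ¬ (a ≈ b)) S
    ε∉S        : ¬ (ε ∈ S)
    S-inv      : ∀ {s} → s ∈ S → (s ⁻¹) ∈ S

  -- vertices g and g ∙ s are adjacent; Path n g h : there is a walk
  -- of length at most n from g to h, i.e. dist(g,h) ≤ n
  data Path : ℕ → Carrier → Carrier → Set where
    stay : ∀ {n g h} → g ≈ h → Path n g h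
    step : ∀ {n g h s} → s ∈ S → Path n (g ∙ s) h → Path (suc n) g h

  degree : ℕ
  degree = length S

  HasOrder : ℕ → Set
  HasOrder N = Inverse setoid (≡.setoid (Fin N))

  HasDiameter : ℕ → Set
  HasDiameter d = (∀ g h → Path d g h) × (∃[ g ] ∃[ h ] ¬ Path (d ∸ 1) g h)

module Submission where

open import Defs
open import Data.Nat using (ℕ; _+_; _*_; _∸_; _^_; _≤_; _<_)
open import Data.Product using (_×_; ∃-syntax)
open import Relation.Binary.PropositionalEquality using (_≡_)

open import Level using (0ℓ; _⊔_)
open import Data.Nat using (zero; suc; z≤n; s≤s; NonZero; >-nonZero; _%_; _/_; _<?_)
import Data.Nat as ℕ
open import Data.Nat.Properties hiding (_≟_)
open import Data.Nat.DivMod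
open import Data.Nat.Divisibility using (_∣_; _∣?_; divides; ∣m∣n⇒∣m+n; ∣m+n∣m⇒∣n; ∣n⇒∣m*n; ∣1⇒≡1; n∣n)
open import Data.Nat.Primality using (euclidsLemma; prime[2])
open import Data.Nat.Solver using (module +-*-Solver)
open import Data.Fin using (Fin; toℕ; fromℕ<; combine; remQuot; funToFin; finToFun; _↑ˡ_; _↑ʳ_)
import Data.Fin as Fin
open import Data.Fin.Properties using (toℕ-fromℕ<; toℕ-injective; toℕ<n; injective⇒≤; fromℕ<-cong; fromℕ<-toℕ;
  toℕ-combine; any?; all?; combine-remQuot; remQuot-combine; funToFin-finToFin; finToFun-funToFin)
import Data.Fin.Properties as FinProperties
open import Data.List using (List; []; _∷_; length; map; _++_; foldl; allFin; applyUpTo; upTo; cartesianProduct)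
open import Data.List.Properties using (length-++; length-map; length-applyUpTo; length-upTo; length-tabulate; foldl-++)
open import Data.List.Relation.Unary.All using (All; []; _∷_)
import Data.List.Relation.Unary.All.Properties as AllProperties
open import Data.List.Relation.Unary.AllPairs using ([]; _∷_)
open import Data.List.Relation.Unary.Any using (here; there)
import Data.List.Relation.Unary.Any as Any
import Data.List.Membership.Setoid as SetoidMembership
import Data.List.Membership.Setoid.Properties as SetoidMembershipProperties
open SetoidMembershipProperties using (∈-resp-≈; ∉⇒All[≉]; ∈-++⁺ˡ; ∈-++⁺ʳ; ∈-++⁻)
import Data.List.Membership.Propositional as PropMembership
open PropMembership using () renaming (_∈_ to _∈ₚ_)
open import Data.List.Membership.Propositional.Properties using (∈-allFin; ∈-applyUpTo⁺; ∈-applyUpTo⁻; ∈-upTo⁺; ∈-upTo⁻;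
  ∈-cartesianProduct⁺; ∈-cartesianProduct⁻) renaming (∈-map⁺ to ∈ₚ-map⁺; ∈-map⁻ to ∈ₚ-map⁻)
import Data.List.Relation.Binary.Subset.Setoid as SetoidSubset
import Data.List.Relation.Unary.Unique.Setoid as SetoidUnique
import Data.List.Relation.Unary.Unique.Setoid.Properties as SetoidUniqueProperties
import Data.List.Relation.Unary.Unique.Propositional as PropUnique
import Data.List.Relation.Unary.Unique.Propositional.Properties as PropUniqueProperties
open import Data.Vec.Functional using () renaming (_++_ to _++ᶠ_)
open import Data.Vec.Functional.Properties using (lookup-++ˡ; lookup-++ʳ)
open import Data.Product using (_,_; proj₁; proj₂; uncurry)
open import Data.Sum using (_⊎_; inj₁; inj₂; [_,_]′)
import Data.Sum as Sum
open import Data.Empty using (⊥-elim)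
open import Relation.Nullary using (¬_; Dec; yes; no; ¬?)
open import Relation.Nullary.Decidable using (_×-dec_; map′; decidable-stable)
open import Relation.Unary using (Pred)
open import Relation.Binary using (Decidable; _Respects_)
open import Relation.Binary.PropositionalEquality as ≡ using (_≢_; refl; sym; trans; cong; cong₂; subst)
open import Algebra.Bundles using (Group)
import Algebra.Properties.Group as GroupProperties
open import Function using (_∘_)
open import Function.Bundles using (Inverse)

-- Take the wreath product ℤ_t ≀ ℤ_r (order r t^r) and arrange the r
-- coordinates in ℓ rows, m rows of k cells and ℓ - m rows of k - 1 cells.  Each
-- generator has at most ℓ nonzero coordinates, and the row-start generators
-- (shift -1, one value per row) let every element be written as k - 1 of them,
-- each writing one offset of every row, followed by one generator that writes the
-- offset k - 1 cells of the first m rows and fixes the shift.  So the diameter is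
-- at most k, while (0 , 1 … 1) differs from the identity in r > (k - 1) ℓ
-- coordinates and thus needs k steps.  The explicit generators are at most
-- 2 t^ℓ + (2r - 3) t^m - r many; the connection set is topped up to exactly that
-- size, symmetrically and keeping sparsity, from a pool of further elements,
-- using a reserved involution (t or r even) or parity (t and r odd) for the last slot.

0%n≡0 : ∀ n .{{_ : NonZero n}} → 0 % n ≡ 0
0%n≡0 (suc n) = refl

[n∸1]*m+m≡n*m : ∀ n .{{_ : NonZero n}} m → (n ∸ 1) * m + m ≡ n * m
[n∸1]*m+m≡n*m (suc n) m = +-comm (n * m) m

module _ {n : ℕ} .{{_ : NonZero n}} where

  open ≡.≡-Reasoning

  %-cong-+ : ∀ {a a′ b b′} → a % n ≡ a′ % n → b % n ≡ b′ % n → (a + b) % n ≡ (a′ + b′) % n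
  %-cong-+ {a} {a′} {b} {b′} p q = begin
    (a + b) % n            ≡⟨ %-distribˡ-+ a b n ⟩
    (a % n + b % n) % n    ≡⟨ cong₂ (λ u v → (u + v) % n) p q ⟩
    (a′ % n + b′ % n) % n  ≡⟨ %-distribˡ-+ a′ b′ n ⟨
    (a′ + b′) % n          ∎

  %-cong-* : ∀ {a a′ b b′} → a % n ≡ a′ % n → b % n ≡ b′ % n → (a * b) % n ≡ (a′ * b′) % n
  %-cong-* {a} {a′} {b} {b′} p q = begin
    (a * b) % n            ≡⟨ %-distribˡ-* a b n ⟩
    (a % n * (b % n)) % n  ≡⟨ cong₂ (λ u v → (u * v) % n) p q ⟩
    (a′ % n * (b′ % n)) % n ≡⟨ %-distribˡ-* a′ b′ n ⟨
    (a′ * b′) % n          ∎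

  [n∸1]*m+m%n≡0 : ∀ a → ((n ∸ 1) * a + a) % n ≡ 0
  [n∸1]*m+m%n≡0 a = begin
    ((n ∸ 1) * a + a) % n  ≡⟨ cong (_% n) ([n∸1]*m+m≡n*m n a) ⟩
    (n * a) % n            ≡⟨ cong (_% n) (*-comm n a) ⟩
    (a * n) % n            ≡⟨ m*n%n≡0 a n ⟩
    0                      ∎

  toℕ-mod : ∀ a → toℕ (a mod n) ≡ a % n
  toℕ-mod a = toℕ-fromℕ< (m%n<n a n)

  mod-cong : ∀ {a b} → a % n ≡ b % n → a mod n ≡ b mod n
  mod-cong {a} {b} p = toℕ-injective (trans (toℕ-mod a) (trans p (sym (toℕ-mod b))))

  toℕ-mod-id : ∀ i → toℕ i mod n ≡ i
  toℕ-mod-id i = toℕ-injective (trans (toℕ-mod (toℕ i)) (m<n⇒m%n≡m (toℕ<n i)))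

  mod-+ : ∀ a b → (toℕ (a mod n) + b) mod n ≡ (a + b) mod n
  mod-+ a b = mod-cong (%-cong-+ (trans (cong (_% n) (toℕ-mod a)) (m%n%n≡m%n a n)) refl)

  %-injective-< : ∀ {a b} → a < n → b < n → a % n ≡ b % n → a ≡ b
  %-injective-< a<n b<n p = trans (sym (m<n⇒m%n≡m a<n)) (trans p (m<n⇒m%n≡m b<n))

  %-cancelʳ-+ : ∀ a b c → (a + c) % n ≡ (b + c) % n → a % n ≡ b % n
  %-cancelʳ-+ a b c p = begin
    a % n                            ≡⟨ undo a ⟨
    (a + c + (n ∸ 1) * c) % n        ≡⟨ %-cong-+ {b = (n ∸ 1) * c} p refl ⟩
    (b + c + (n ∸ 1) * c) % n        ≡⟨ undo b ⟩
    b % n                            ∎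
    where
    undo : ∀ x → (x + c + (n ∸ 1) * c) % n ≡ x % n
    undo x = begin
      (x + c + (n ∸ 1) * c) % n  ≡⟨ cong (_% n) (+-assoc x c _) ⟩
      (x + (c + (n ∸ 1) * c)) % n ≡⟨ cong (λ y → (x + y) % n) (trans (+-comm c _) ([n∸1]*m+m≡n*m n c)) ⟩
      (x + n * c) % n            ≡⟨ cong (λ y → (x + y) % n) (*-comm n c) ⟩
      (x + c * n) % n            ≡⟨ [m+kn]%n≡m%n x c n ⟩
      x % n                      ∎

[n∸1]*m+m%n≡0%n : ∀ n .{{_ : NonZero n}} a → ((n ∸ 1) * a + a) % n ≡ 0 % n
[n∸1]*m+m%n≡0%n n a = trans ([n∸1]*m+m%n≡0 a) (sym (0%n≡0 n))

[n∸1]*m%n≡[n∸m]%n : ∀ n .{{_ : NonZero n}} {c} → 1 ≤ c → c ≤ n → ((n ∸ 1) * c) % n ≡ (n ∸ c) % n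
[n∸1]*m%n≡[n∸m]%n n {suc c} _ c≤n = trans (cong (_% n) identity) ([m+kn]%n≡m%n d c n)
  where
  open ≡.≡-Reasoning
  open +-*-Solver
  d = n ∸ suc c
  n≡ : n ≡ suc c + d
  n≡ = sym (m+[n∸m]≡n c≤n)
  identity : (n ∸ 1) * suc c ≡ d + c * n
  identity = begin
    (n ∸ 1) * suc c      ≡⟨ cong (λ u → (u ∸ 1) * suc c) n≡ ⟩
    (c + d) * suc c      ≡⟨ solve 2 (λ c d → (c :+ d) :* (con 1 :+ c) := d :+ c :* (con 1 :+ c :+ d)) refl c d ⟩
    d + c * (suc c + d)  ≡⟨ cong (λ u → d + c * u) n≡ ⟨
    d + c * n            ∎

surjection⇒≤ : ∀ {m n} (f : Fin m → Fin n) → (∀ w → ∃[ q ] f q ≡ w) → n ≤ m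
surjection⇒≤ f f-onto = injective⇒≤ {f = section} section-injective
  where
  section = λ w → proj₁ (f-onto w)
  section-injective : ∀ {v w} → section v ≡ section w → v ≡ w
  section-injective {v} {w} p = trans (sym (proj₂ (f-onto v))) (trans (cong f p) (proj₂ (f-onto w)))

funToFin-cong : ∀ {m n} {f g : Fin m → Fin n} → (∀ i → f i ≡ g i) → funToFin f ≡ funToFin g
funToFin-cong {zero}  _   = refl
funToFin-cong {suc m} f≗g = cong₂ combine (f≗g Fin.zero) (funToFin-cong (f≗g ∘ Fin.suc))

2∣n⇒2∤1+n : ∀ {n} → 2 ∣ n → ¬ 2 ∣ suc n
2∣n⇒2∤1+n {n} 2∣n 2∣1+n with () ← ∣1⇒≡1 (∣m+n∣m⇒∣n (subst (2 ∣_) (+-comm 1 n) 2∣1+n) 2∣n)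

2∣n+n : ∀ n → 2 ∣ n + n
2∣n+n n = divides n (trans (cong (n +_) (sym (+-identityʳ n))) (*-comm 2 n))

2∣⇒≡h+h : ∀ {n} → 2 ∣ n → ∃[ h ] n ≡ h + h
2∣⇒≡h+h (divides h refl) = h , trans (*-comm h 2) (cong (h +_) (+-identityʳ h))

2∣n⊎2∣1+n : ∀ n → 2 ∣ n ⊎ 2 ∣ suc n
2∣n⊎2∣1+n zero = inj₁ (divides 0 refl)
2∣n⊎2∣1+n (suc n) with 2∣n⊎2∣1+n n
... | inj₁ 2∣n   = inj₂ (∣m∣n⇒∣m+n n∣n 2∣n)
... | inj₂ 2∣1+n = inj₁ 2∣1+n

2∤1+n⇒2∣n : ∀ {n} → ¬ 2 ∣ suc n → 2 ∣ n
2∤1+n⇒2∣n {n} 2∤1+n with 2∣n⊎2∣1+n n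
... | inj₁ 2∣n   = 2∣n
... | inj₂ 2∣1+n with () ← 2∤1+n 2∣1+n

2∤m⇒2∤m^n : ∀ {m} → ¬ 2 ∣ m → ∀ n → ¬ 2 ∣ m ^ n
2∤m⇒2∤m^n 2∤m zero 2∣1 with () ← ∣1⇒≡1 2∣1
2∤m⇒2∤m^n {m} 2∤m (suc n) 2∣m^1+n with euclidsLemma m (m ^ n) prime[2] 2∣m^1+n
... | inj₁ 2∣m   = 2∤m 2∣m
... | inj₂ 2∣m^n = 2∤m⇒2∤m^n 2∤m n 2∣m^n

[n∸1]*m%n≡m%n⇒m%n≡0 : ∀ n .{{_ : NonZero n}} → ¬ 2 ∣ n → ∀ v → ((n ∸ 1) * v) % n ≡ v % n → v % n ≡ 0
[n∸1]*m%n≡m%n⇒m%n≡0 n 2∤n v p with v % n in v%n≡w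
... | zero  = refl
... | suc w = ⊥-elim (2∤n (subst (2 ∣_) (sym n≡w′+w′) (2∣n+n w′)))
  where
  open ≡.≡-Reasoning
  w′ = suc w
  w′<n : w′ < n
  w′<n = subst (_< n) v%n≡w (m%n<n v n)
  n∸w′≡w′ : n ∸ w′ ≡ w′
  n∸w′≡w′ = begin
    n ∸ w′                ≡⟨ m<n⇒m%n≡m (∸-monoʳ-< {n} {w′} {0} (s≤s z≤n) (<⇒≤ w′<n)) ⟨
    (n ∸ w′) % n          ≡⟨ [n∸1]*m%n≡[n∸m]%n n (s≤s z≤n) (<⇒≤ w′<n) ⟨
    ((n ∸ 1) * w′) % n    ≡⟨ %-cong-* {a = n ∸ 1} refl (trans (m<n⇒m%n≡m w′<n) (sym v%n≡w)) ⟩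
    ((n ∸ 1) * v) % n     ≡⟨ p ⟩
    w′                    ∎
  n≡w′+w′ : n ≡ w′ + w′
  n≡w′+w′ = trans (sym (m+[n∸m]≡n (<⇒≤ w′<n))) (cong (w′ +_) n∸w′≡w′)

q*n+j/n≡q : ∀ q j n .{{_ : NonZero n}} → j < n → (q * n + j) / n ≡ q
q*n+j/n≡q q j n j<n = begin
  (q * n + j) / n    ≡⟨ +-distrib-/ (q * n) j rem< ⟩
  q * n / n + j / n  ≡⟨ cong₂ _+_ (m*n/n≡m q n) (m<n⇒m/n≡0 j<n) ⟩
  q + 0              ≡⟨ +-identityʳ q ⟩
  q                  ∎
  where
  open ≡.≡-Reasoning
  rem< : (q * n) % n + j % n < n
  rem< = subst (_< n) (sym (cong₂ _+_ (m*n%n≡0 q n) (m<n⇒m%n≡m j<n))) j<n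

q*n+j%n≡j : ∀ q j n .{{_ : NonZero n}} → j < n → (q * n + j) % n ≡ j
q*n+j%n≡j q j n j<n = trans (cong (_% n) (+-comm (q * n) j)) (trans ([m+kn]%n≡m%n j q n) (m<n⇒m%n≡m j<n))

toℕ-funToFin≡0 : ∀ {m n} (f : Fin m → Fin n) → (∀ q → toℕ (f q) ≡ 0) → toℕ (funToFin f) ≡ 0
toℕ-funToFin≡0 {zero}      f f≡0 = refl
toℕ-funToFin≡0 {suc m} {n} f f≡0 = begin
  toℕ (combine (f Fin.zero) (funToFin (f ∘ Fin.suc)))   ≡⟨ toℕ-combine (f Fin.zero) _ ⟩
  n ^ m * toℕ (f Fin.zero) + toℕ (funToFin (f ∘ Fin.suc)) ≡⟨ cong₂ _+_ (trans (cong (n ^ m *_) (f≡0 Fin.zero)) (*-zeroʳ (n ^ m)))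
                                                                          (toℕ-funToFin≡0 (f ∘ Fin.suc) (f≡0 ∘ Fin.suc)) ⟩
  0                                                      ∎
  where open ≡.≡-Reasoning

toℕ-funToFin≡0⁻¹ : ∀ {m n} .{{_ : NonZero n}} (f : Fin m → Fin n) → toℕ (funToFin f) ≡ 0 → ∀ q → toℕ (f q) ≡ 0
toℕ-funToFin≡0⁻¹ {suc m} {n} f p Fin.zero =
  m*n≡0⇒m≡0 (toℕ (f Fin.zero)) (n ^ m) {{m^n≢0 n m}}
    (trans (*-comm (toℕ (f Fin.zero)) (n ^ m)) (m+n≡0⇒m≡0 _ (trans (sym (toℕ-combine (f Fin.zero) _)) p)))
toℕ-funToFin≡0⁻¹ {suc m} {n} f p (Fin.suc q) =
  toℕ-funToFin≡0⁻¹ (f ∘ Fin.suc) (m+n≡0⇒n≡0 _ (trans (sym (toℕ-combine (f Fin.zero) _)) p)) q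

nonzeroFins : ∀ n → List (Fin n)
nonzeroFins zero    = []
nonzeroFins (suc n) = map Fin.suc (allFin n)

∈-nonzeroFins⁺ : ∀ {n} {u : Fin n} → ¬ toℕ u ≡ 0 → u ∈ₚ nonzeroFins n
∈-nonzeroFins⁺ {suc n} {Fin.zero}  u≢0 = ⊥-elim (u≢0 refl)
∈-nonzeroFins⁺ {suc n} {Fin.suc u} _   = ∈ₚ-map⁺ Fin.suc (∈-allFin u)

∈-nonzeroFins⁻ : ∀ {n} {u : Fin n} → u ∈ₚ nonzeroFins n → ¬ toℕ u ≡ 0
∈-nonzeroFins⁻ {suc n} u∈ with ∈ₚ-map⁻ Fin.suc u∈
... | _ , _ , refl = λ ()

length-nonzeroFins : ∀ n → length (nonzeroFins n) ≡ n ∸ 1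
length-nonzeroFins zero    = refl
length-nonzeroFins (suc n) = trans (length-map Fin.suc (allFin n)) (length-tabulate (λ i → i))

length-cartesianProduct : ∀ {A B : Set} (xs : List A) (ys : List B) →
                          length (cartesianProduct xs ys) ≡ length xs * length ys
length-cartesianProduct []       ys = refl
length-cartesianProduct (x ∷ xs) ys = trans (length-++ (map (x ,_) ys))
  (cong₂ _+_ (length-map (x ,_) ys) (length-cartesianProduct xs ys))

unique-nonzeroFins : ∀ n → PropUnique.Unique (nonzeroFins n)
unique-nonzeroFins zero    = []
unique-nonzeroFins (suc n) = PropUniqueProperties.map⁺ FinProperties.suc-injective (PropUniqueProperties.allFin⁺ n)

module Padding {a ℓ p} (G : Group a ℓ) (_≟_ : Decidable (Group._≈_ G))
               (P : Pred (Group.Carrier G) p) (P-resp : P Respects Group._≈_ G)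
               (P-⁻¹ : ∀ {x} → P x → P (Group._⁻¹ G x)) where

  open Group G renaming (refl to ≈-refl; sym to ≈-sym; trans to ≈-trans)
  open GroupProperties G using (⁻¹-involutive; ⁻¹-injective; ε⁻¹≈ε)
  open SetoidMembership setoid using (_∈_; _∉_)
  open SetoidSubset setoid using (_⊆_)
  open SetoidUnique setoid using (Unique)

  ⁻¹≈ε⇒≈ε : ∀ {x} → x ⁻¹ ≈ ε → x ≈ ε
  ⁻¹≈ε⇒≈ε x⁻¹≈ε = ⁻¹-injective (≈-trans x⁻¹≈ε (≈-sym ε⁻¹≈ε))

  _∈?_ : ∀ x xs → Dec (x ∈ xs)
  x ∈? xs = Any.any? (x ≟_) xs

  ⊆⊎∃∉ : ∀ xs ys → xs ⊆ ys ⊎ ∃[ x ] x ∈ xs × x ∉ ys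
  ⊆⊎∃∉ []       ys = inj₁ (λ ())
  ⊆⊎∃∉ (x ∷ xs) ys with x ∈? ys | ⊆⊎∃∉ xs ys
  ... | no x∉ys | _                  = inj₂ (x , here ≈-refl , x∉ys)
  ... | yes _   | inj₂ (z , z∈ , z∉) = inj₂ (z , there z∈ , z∉)
  ... | yes x∈ys | inj₁ xs⊆ys        = inj₁ λ { (here z≈x) → ∈-resp-≈ setoid (≈-sym z≈x) x∈ys ; (there z∈) → xs⊆ys z∈ }

  private
    _─_ : ∀ {x} xs → x ∈ xs → List Carrier
    (_ ∷ xs) ─ here _    = xs
    (y ∷ xs) ─ there x∈ = y ∷ (xs ─ x∈)

    length-─ : ∀ {x} xs (x∈ : x ∈ xs) → length xs ≡ suc (length (xs ─ x∈))
    length-─ (_ ∷ xs) (here _)   = refl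
    length-─ (_ ∷ xs) (there x∈) = cong suc (length-─ xs x∈)

    ∈-─ : ∀ {x z} xs (x∈ : x ∈ xs) → z ∈ xs → ¬ z ≈ x → z ∈ xs ─ x∈
    ∈-─ (_ ∷ _)  (here x≈y) (here z≈y) z≉x = ⊥-elim (z≉x (≈-trans z≈y (≈-sym x≈y)))
    ∈-─ (_ ∷ _)  (here _)   (there z∈) _   = z∈
    ∈-─ (_ ∷ _)  (there _)  (here z≈y) _   = here z≈y
    ∈-─ (_ ∷ xs) (there x∈) (there z∈) z≉x = there (∈-─ xs x∈ z∈ z≉x)

  unique⇒length-≤ : ∀ {xs ys} → Unique xs → xs ⊆ ys → length xs ≤ length ys
  unique⇒length-≤ {[]}     _          _  = z≤n
  unique⇒length-≤ {x ∷ xs} {ys} (x≉xs ∷ u) xs⊆ys = begin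
    suc (length xs)        ≤⟨ s≤s (unique⇒length-≤ u xs⊆ys─x) ⟩
    suc (length (ys ─ x∈)) ≡⟨ length-─ ys x∈ ⟨
    length ys              ∎
    where
    open ≤-Reasoning
    x∈ = xs⊆ys (here ≈-refl)
    ≉x : ∀ {zs z} → All (λ y → ¬ x ≈ y) zs → z ∈ zs → ¬ z ≈ x
    ≉x (x≉z ∷ _)   (here z≈w) z≈x = x≉z (≈-trans (≈-sym z≈x) z≈w)
    ≉x (_ ∷ x≉zs) (there z∈)      = ≉x x≉zs z∈
    xs⊆ys─x : xs ⊆ ys ─ x∈
    xs⊆ys─x z∈ = ∈-─ ys x∈ (xs⊆ys (there z∈)) (≉x x≉xs z∈)

  record IsConnectionSet (S : List Carrier) : Set (a ⊔ ℓ ⊔ p) where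
    field
      unique    : Unique S
      ε∉        : ε ∉ S
      ⁻¹-closed : ∀ {s} → s ∈ S → s ⁻¹ ∈ S
      sat       : ∀ {s} → s ∈ S → P s

  open IsConnectionSet

  NoInvolution : Set (a ⊔ ℓ)
  NoInvolution = ∀ x → x ⁻¹ ≈ x → x ≈ ε

  []-isConnectionSet : IsConnectionSet []
  []-isConnectionSet = record { unique = [] ; ε∉ = λ () ; ⁻¹-closed = λ () ; sat = λ () }

  record Insertion (x : Carrier) (S : List Carrier) : Set (a ⊔ ℓ ⊔ p) where
    field
      S′        : List Carrier
      conn      : IsConnectionSet S′
      ⊇S        : S ⊆ S′
      x∈        : x ∈ S′
      ⊆S∪x±     : ∀ {y} → y ∈ S′ → y ∈ S ⊎ (y ≈ x ⊎ y ≈ x ⁻¹)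
      length-S′ : (x ⁻¹ ≈ x × length S′ ≡ 1 + length S) ⊎ (¬ x ⁻¹ ≈ x × length S′ ≡ 2 + length S)

  insert : ∀ {x S} → IsConnectionSet S → x ∉ S → P x → ¬ x ≈ ε → Insertion x S
  insert {x} {S} conn-S x∉S Px x≉ε with (x ⁻¹) ≟ x
  ... | yes x⁻¹≈x = record
    { S′ = x ∷ S
    ; conn = record
      { unique    = ∉⇒All[≉] setoid x∉S ∷ unique conn-S
      ; ε∉        = λ { (here ε≈x) → x≉ε (≈-sym ε≈x) ; (there ε∈) → ε∉ conn-S ε∈ }
      ; ⁻¹-closed = λ { (here s≈x) → here (≈-trans (⁻¹-cong s≈x) x⁻¹≈x) ; (there s∈) → there (⁻¹-closed conn-S s∈) }
      ; sat       = λ { (here s≈x) → P-resp (≈-sym s≈x) Px ; (there s∈) → sat conn-S s∈ } }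
    ; ⊇S = there
    ; x∈ = here ≈-refl
    ; ⊆S∪x± = λ { (here y≈x) → inj₂ (inj₁ y≈x) ; (there y∈) → inj₁ y∈ }
    ; length-S′ = inj₁ (x⁻¹≈x , refl) }
  ... | no x⁻¹≉x = record
    { S′ = x ∷ x ⁻¹ ∷ S
    ; conn = record
      { unique    = ((λ x≈x⁻¹ → x⁻¹≉x (≈-sym x≈x⁻¹)) ∷ ∉⇒All[≉] setoid x∉S) ∷ ∉⇒All[≉] setoid x⁻¹∉S ∷ unique conn-S
      ; ε∉        = λ { (here ε≈x) → x≉ε (≈-sym ε≈x)
                      ; (there (here ε≈x⁻¹)) → x≉ε (⁻¹≈ε⇒≈ε (≈-sym ε≈x⁻¹))
                      ; (there (there ε∈)) → ε∉ conn-S ε∈ }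
      ; ⁻¹-closed = λ { (here s≈x) → there (here (⁻¹-cong s≈x))
                      ; (there (here s≈x⁻¹)) → here (≈-trans (⁻¹-cong s≈x⁻¹) (⁻¹-involutive x))
                      ; (there (there s∈)) → there (there (⁻¹-closed conn-S s∈)) }
      ; sat       = λ { (here s≈x) → P-resp (≈-sym s≈x) Px
                      ; (there (here s≈x⁻¹)) → P-resp (≈-sym s≈x⁻¹) (P-⁻¹ Px)
                      ; (there (there s∈)) → sat conn-S s∈ } }
    ; ⊇S = λ s∈ → there (there s∈)
    ; x∈ = here ≈-refl
    ; ⊆S∪x± = λ { (here y≈x) → inj₂ (inj₁ y≈x) ; (there (here y≈x⁻¹)) → inj₂ (inj₂ y≈x⁻¹)
                ; (there (there y∈)) → inj₁ y∈ }
    ; length-S′ = inj₂ (x⁻¹≉x , refl) }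
    where
    x⁻¹∉S : x ⁻¹ ∉ S
    x⁻¹∉S x⁻¹∈ = x∉S (∈-resp-≈ setoid (⁻¹-involutive x) (⁻¹-closed conn-S x⁻¹∈))

  EvenUnderNoInvolution : List Carrier → Set (a ⊔ ℓ)
  EvenUnderNoInvolution S = NoInvolution → 2 ∣ length S

  insert-even : ∀ {x S} (ins : Insertion x S) → ¬ x ≈ ε →
                EvenUnderNoInvolution S → EvenUnderNoInvolution (Insertion.S′ ins)
  insert-even ins x≉ε even noInv with Insertion.length-S′ ins
  ... | inj₁ (x⁻¹≈x , _)   = ⊥-elim (x≉ε (noInv _ x⁻¹≈x))
  ... | inj₂ (_ , ≡len) rewrite ≡len = ∣m∣n⇒∣m+n n∣n (even noInv)

  module _ {C : List Carrier} (C-⁻¹ : ∀ {x} → x ∈ C → x ⁻¹ ∈ C)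
           (C-P : ∀ {x} → x ∈ C → P x) (ε∉C : ε ∉ C) where

    record Closure (xs : List Carrier) : Set (a ⊔ ℓ ⊔ p) where
      field
        S    : List Carrier
        conn : IsConnectionSet S
        S⊆C  : S ⊆ C
        xs⊆S : xs ⊆ S
        even : EvenUnderNoInvolution S

    closure : ∀ xs → xs ⊆ C → Closure xs
    closure [] _ = record { S = [] ; conn = []-isConnectionSet ; S⊆C = λ () ; xs⊆S = λ () ; even = λ _ → divides 0 refl }
    closure (x ∷ xs) x∷xs⊆C with closure xs (λ y∈ → x∷xs⊆C (there y∈))
    ... | cl with x ∈? Closure.S cl
    ...   | yes x∈S = record
      { S = S ; conn = conn ; S⊆C = S⊆C ; even = even
      ; xs⊆S = λ { (here y≈x) → ∈-resp-≈ setoid (≈-sym y≈x) x∈S ; (there y∈) → xs⊆S y∈ } }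
      where open Closure cl
    ...   | no x∉S = record
      { S = S′ ; conn = conn ; even = insert-even ins x≉ε (Closure.even cl)
      ; S⊆C = λ y∈ → from (⊆S∪x± y∈)
      ; xs⊆S = λ { (here y≈x) → ∈-resp-≈ setoid (≈-sym y≈x) x∈ ; (there y∈) → ⊇S (Closure.xs⊆S cl y∈) } }
      where
      x∈C = x∷xs⊆C (here ≈-refl)
      x≉ε : ¬ x ≈ ε
      x≉ε x≈ε = ε∉C (∈-resp-≈ setoid x≈ε x∈C)
      ins = insert (Closure.conn cl) x∉S (C-P x∈C) x≉ε
      open Insertion ins
      from : ∀ {y} → y ∈ Closure.S cl ⊎ (y ≈ x ⊎ y ≈ x ⁻¹) → y ∈ C
      from (inj₁ y∈)         = Closure.S⊆C cl y∈
      from (inj₂ (inj₁ y≈x)) = ∈-resp-≈ setoid (≈-sym y≈x) x∈C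
      from (inj₂ (inj₂ y≈x⁻¹)) = ∈-resp-≈ setoid (≈-sym y≈x⁻¹) (C-⁻¹ x∈C)

  -- How a connection set of size D is completed when one element is missing:
  -- by an involution kept in reserve, or not at all since the parity rules it out.
  data ParityRepair (C : List Carrier) (D : ℕ) : Set (a ⊔ ℓ ⊔ p) where
    involution : ∀ j → j ⁻¹ ≈ j → ¬ j ≈ ε → P j → j ∉ C → ParityRepair C D
    involution-free : NoInvolution → 2 ∣ D → ParityRepair C D

  module _ {C : List Carrier} {D : ℕ} where

    reserved : ParityRepair C D → List Carrier
    reserved (involution j _ _ _ _) = j ∷ []
    reserved (involution-free _ _)           = []

    length-reserved : ∀ repair → length (reserved repair) ≤ 1
    length-reserved (involution _ _ _ _ _) = s≤s z≤n
    length-reserved (involution-free _ _)           = z≤n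

    reserved-involution : ∀ repair {y} → y ∈ reserved repair → y ⁻¹ ≈ y
    reserved-involution (involution j j⁻¹≈j _ _ _) (here y≈j) = ≈-trans (⁻¹-cong y≈j) (≈-trans j⁻¹≈j (≈-sym y≈j))

    reserved∉C : ∀ repair {y} → y ∈ reserved repair → y ∉ C
    reserved∉C (involution j _ _ _ j∉C) (here y≈j) y∈C = j∉C (∈-resp-≈ setoid y≈j y∈C)

    reserved∉-insert : ∀ repair {x S} → x ∉ reserved repair ++ S → (∀ {y} → y ∈ reserved repair → y ∉ S) →
                       (ins : Insertion x S) → ∀ {y} → y ∈ reserved repair → y ∉ Insertion.S′ ins
    reserved∉-insert repair {x} x∉R++S R∉S ins {y} y∈R y∈S′ = from (Insertion.⊆S∪x± ins y∈S′)
      where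
      x∈R : y ≈ x → x ∈ reserved repair ++ _
      x∈R y≈x = ∈-++⁺ˡ setoid (∈-resp-≈ setoid y≈x y∈R)
      from : _ → _
      from (inj₁ y∈S)          = R∉S y∈R y∈S
      from (inj₂ (inj₁ y≈x))   = x∉R++S (x∈R y≈x)
      from (inj₂ (inj₂ y≈x⁻¹)) = x∉R++S (x∈R (≈-trans (≈-sym (reserved-involution repair y∈R))
                                                    (≈-trans (⁻¹-cong y≈x⁻¹) (⁻¹-involutive x))))

  module _ {C M : List Carrier} {D : ℕ}
           (M-unique : Unique M) (M-P : ∀ {x} → x ∈ M → P x) (ε∉M : ε ∉ M) (D≤|M| : D ≤ length M) where

    fresh : (repair : ParityRepair C D) → ∀ S → length S + 2 ≤ D → ∃[ x ] x ∈ M × x ∉ reserved repair ++ S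
    fresh repair S |S|+2≤D with ⊆⊎∃∉ M (reserved repair ++ S)
    ... | inj₂ x∉ = x∉
    ... | inj₁ M⊆ = ⊥-elim (<⇒≱ |R++S|<|M| (unique⇒length-≤ M-unique M⊆))
      where
      open ≤-Reasoning
      |R++S|<|M| : length (reserved repair ++ S) < length M
      |R++S|<|M| = begin-strict
        length (reserved repair ++ S)          ≡⟨ length-++ (reserved repair) ⟩
        length (reserved repair) + length S      ≤⟨ +-monoˡ-≤ (length S) (length-reserved repair) ⟩
        1 + length S                    <⟨ ≤-reflexive (+-comm 2 (length S)) ⟩
        length S + 2                    ≤⟨ |S|+2≤D ⟩
        D                               ≤⟨ D≤|M| ⟩
        length M                        ∎

    Padded : Set (a ⊔ ℓ ⊔ p)
    Padded = ∃[ S ] IsConnectionSet S × length S ≡ D × C ⊆ S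

    PadFrom : ParityRepair C D → ℕ → Set (a ⊔ ℓ ⊔ p)
    PadFrom repair g = ∀ S → IsConnectionSet S → length S + g ≡ D → (∀ {y} → y ∈ reserved repair → y ∉ S) →
                       EvenUnderNoInvolution S → C ⊆ S → Padded

    pad : ∀ repair g → PadFrom repair g
    pad _ zero S conn |S|≡D _ _ C⊆S = S , conn , trans (sym (+-identityʳ _)) |S|≡D , C⊆S
    pad repair (suc zero) S conn |S|+1≡D R∉S evenS C⊆S with repair
    ... | involution-free noInv 2∣D = ⊥-elim (2∣n⇒2∤1+n (evenS noInv) (subst (2 ∣_) (trans (sym |S|+1≡D) (+-comm (length S) 1)) 2∣D))
    ... | involution j j⁻¹≈j j≉ε Pj j∉C with insert conn (R∉S (here ≈-refl)) Pj j≉ε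
    ...   | ins with Insertion.length-S′ ins
    ...     | inj₁ (_ , ≡len)   = S′ , conn′ , trans ≡len (trans (+-comm 1 (length S)) |S|+1≡D) , λ c∈ → ⊇S (C⊆S c∈)
      where open Insertion ins renaming (conn to conn′)
    ...     | inj₂ (j⁻¹≉j , _) = ⊥-elim (j⁻¹≉j j⁻¹≈j)
    pad repair (suc (suc g)) S conn |S|+g+2≡D R∉S evenS C⊆S =
      continue (insert conn x∉S (M-P x∈M) x≉ε) (pad repair (suc g)) (pad repair g)
      where
      |S|+2≤D : length S + 2 ≤ D
      |S|+2≤D = ≤-trans (+-monoʳ-≤ (length S) (m≤m+n 2 g)) (≤-reflexive |S|+g+2≡D)
      x : Carrier
      x = proj₁ (fresh repair S |S|+2≤D)
      x∈M : x ∈ M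
      x∈M = proj₁ (proj₂ (fresh repair S |S|+2≤D))
      x∉R++S : x ∉ reserved repair ++ S
      x∉R++S = proj₂ (proj₂ (fresh repair S |S|+2≤D))
      x∉S : x ∉ S
      x∉S x∈S = x∉R++S (∈-++⁺ʳ setoid (reserved repair) x∈S)
      x≉ε : ¬ x ≈ ε
      x≉ε x≈ε = ε∉M (∈-resp-≈ setoid x≈ε x∈M)
      continue : Insertion x S → PadFrom repair (suc g) → PadFrom repair g → Padded
      continue ins pad₁ pad₀ with Insertion.length-S′ ins
      ... | inj₁ (x⁻¹≈x , ≡len) =
        pad₁ S′ conn′ (trans (cong (_+ suc g) ≡len) (trans (sym (+-suc (length S) (suc g))) |S|+g+2≡D))
            (reserved∉-insert repair x∉R++S R∉S ins) (λ noInv → ⊥-elim (x≉ε (noInv x x⁻¹≈x))) (λ c∈ → ⊇S (C⊆S c∈))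
        where open Insertion ins renaming (conn to conn′)
      ... | inj₂ (_ , ≡len) =
        pad₀ S′ conn′ (trans (cong (_+ g) ≡len) (trans (sym (trans (+-suc (length S) (suc g)) (cong suc (+-suc (length S) g)))) |S|+g+2≡D))
            (reserved∉-insert repair x∉R++S R∉S ins) (insert-even ins x≉ε evenS) (λ c∈ → ⊇S (C⊆S c∈))
        where open Insertion ins renaming (conn to conn′)

    padding : ParityRepair C D → (∀ {x} → x ∈ C → x ⁻¹ ∈ C) → (∀ {x} → x ∈ C → P x) → ε ∉ C →
              length C ≤ D → Padded
    padding repair C-⁻¹ C-P ε∉C |C|≤D =
      pad repair (D ∸ length S) S conn (m+[n∸m]≡n |S|≤D) (λ y∈R y∈S → reserved∉C repair y∈R (S⊆C y∈S)) even xs⊆S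
      where
      open Closure (closure C-⁻¹ C-P ε∉C C (λ x∈ → x∈))
      |S|≤D : length S ≤ D
      |S|≤D = ≤-trans (unique⇒length-≤ (IsConnectionSet.unique conn) S⊆C) |C|≤D

module CayleyPaths (Γ : CayleyGraph) where

  open CayleyGraph Γ using (Path; stay; step; S; _∈_; _≈_; _∙_; ε; _⁻¹; setoid; assoc; identityˡ; identityʳ;
    inverseʳ; ∙-cong; ∙-congˡ; ∙-congʳ) renaming (refl to ≈-refl; sym to ≈-sym; trans to ≈-trans)

  path-mono : ∀ {n n′ g h} → n ≤ n′ → Path n g h → Path n′ g h
  path-mono _           (stay g≈h)    = stay g≈h
  path-mono (s≤s n≤n′) (step s∈S p) = step s∈S (path-mono n≤n′ p)

  foldl-cong : ∀ L {u v} → u ≈ v → foldl _∙_ u L ≈ foldl _∙_ v L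
  foldl-cong []      u≈v = u≈v
  foldl-cong (s ∷ L) u≈v = foldl-cong L (∙-cong u≈v ≈-refl)

  foldl-∙ : ∀ L g u → foldl _∙_ (g ∙ u) L ≈ g ∙ foldl _∙_ u L
  foldl-∙ []      g u = ≈-refl
  foldl-∙ (s ∷ L) g u = ≈-trans (foldl-cong L (assoc g u s)) (foldl-∙ L g (u ∙ s))

  walk : ∀ {L} g h → All (_∈ S) L → h ≈ foldl _∙_ g L → Path (length L) g h
  walk g h []           h≈g = stay (≈-sym h≈g)
  walk g h (s∈S ∷ L∈S) h≈  = step s∈S (walk _ h L∈S h≈)

  path-from-word : ∀ {L g h} → All (_∈ S) L → foldl _∙_ ε L ≈ g ⁻¹ ∙ h → Path (length L) g h
  path-from-word {L} {g} {h} L∈S word≈ = walk g h L∈S (≈-sym (begin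
    foldl _∙_ g L          ≈⟨ foldl-cong L (≈-sym (identityʳ g)) ⟩
    foldl _∙_ (g ∙ ε) L    ≈⟨ foldl-∙ L g ε ⟩
    g ∙ foldl _∙_ ε L      ≈⟨ ∙-congˡ word≈ ⟩
    g ∙ (g ⁻¹ ∙ h)         ≈⟨ assoc g (g ⁻¹) h ⟨
    g ∙ g ⁻¹ ∙ h           ≈⟨ ∙-congʳ (inverseʳ g) ⟩
    ε ∙ h                  ≈⟨ identityˡ h ⟩
    h                      ∎))
    where open import Relation.Binary.Reasoning.Setoid setoid

-- The wreath product ℤ_t ≀ ℤ_r = ℤ_r ⋉ ℤ_t^r, ℤ_r acting on the coordinates by
-- rotation.  Elements are pairs (a , x) of naturals read modulo r and modulo t.
module Wreath (r t : ℕ) .{{_ : NonZero r}} .{{_ : NonZero t}} where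

  Coords : Set
  Coords = Fin r → ℕ

  Element : Set
  Element = ℕ × Coords

  infix 4 _≋_ _≈_
  _≋_ : Coords → Coords → Set
  x ≋ y = ∀ i → x i % t ≡ y i % t

  record _≈_ (g h : Element) : Set where
    constructor _,≈_
    field
      ≈-shift  : proj₁ g % r ≡ proj₁ h % r
      ≈-coords : proj₂ g ≋ proj₂ h
  open _≈_ public

  rot : ℕ → Coords → Coords
  rot a x i = x ((toℕ i + a) mod r)

  rot-cong : ∀ {a b} x → a % r ≡ b % r → ∀ i → rot a x i ≡ rot b x i
  rot-cong x p i = cong x (mod-cong (%-cong-+ {a = toℕ i} refl p))

  rot-rot : ∀ a b x i → rot a (rot b x) i ≡ rot (a + b) x i
  rot-rot a b x i = cong x (trans (mod-+ (toℕ i + a) b) (cong (_mod r) (+-assoc (toℕ i) a b)))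

  rot-0 : ∀ x i → rot 0 x i ≡ x i
  rot-0 x i = cong x (trans (cong (_mod r) (+-identityʳ (toℕ i))) (toℕ-mod-id i))

  rot-≡0 : ∀ {a} x → a % r ≡ 0 → ∀ i → rot a x i ≡ x i
  rot-≡0 x p i = trans (rot-cong x (trans p (sym (0%n≡0 r))) i) (rot-0 x i)

  infixl 7 _∙_
  _∙_ : Element → Element → Element
  (a , x) ∙ (b , y) = a + b , λ i → x i + rot a y i

  ε : Element
  ε = 0 , λ _ → 0

  -- (r ∸ 1) * a and (t ∸ 1) * y stand for -a modulo r and -y modulo t.
  infix 8 _⁻¹
  _⁻¹ : Element → Element
  (a , x) ⁻¹ = (r ∸ 1) * a , λ i → (t ∸ 1) * rot ((r ∸ 1) * a) x i

  ≈-refl : ∀ {g} → g ≈ g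
  ≈-refl = refl ,≈ λ _ → refl

  ≈-sym : ∀ {g h} → g ≈ h → h ≈ g
  ≈-sym (p ,≈ q) = sym p ,≈ λ i → sym (q i)

  ≈-trans : ∀ {g h k} → g ≈ h → h ≈ k → g ≈ k
  ≈-trans (p ,≈ q) (p′ ,≈ q′) = trans p p′ ,≈ λ i → trans (q i) (q′ i)

  ≡⇒≈ : ∀ {a b x y} → a ≡ b → (∀ i → x i ≡ y i) → (a , x) ≈ (b , y)
  ≡⇒≈ p q = cong (_% r) p ,≈ λ i → cong (_% t) (q i)

  ∙-cong : ∀ {g g′ h h′} → g ≈ g′ → h ≈ h′ → g ∙ h ≈ g′ ∙ h′
  ∙-cong {a , x} {b , _} {_ , y} (p ,≈ q) (p′ ,≈ q′) =
    %-cong-+ p p′ ,≈ λ i → %-cong-+ (q i) (trans (cong (_% t) (rot-cong y p i)) (q′ _))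

  assoc : ∀ g h k → (g ∙ h) ∙ k ≈ g ∙ (h ∙ k)
  assoc (a , x) (b , y) (c , z) = ≡⇒≈ (+-assoc a b c) λ i →
    trans (+-assoc (x i) _ _) (cong (λ u → x i + (rot a y i + u)) (sym (rot-rot a b z i)))

  identityˡ : ∀ g → ε ∙ g ≈ g
  identityˡ (a , x) = ≡⇒≈ refl (rot-0 x)

  identityʳ : ∀ g → g ∙ ε ≈ g
  identityʳ (a , x) = ≡⇒≈ (+-identityʳ a) λ i → +-identityʳ (x i)

  inverseˡ : ∀ g → g ⁻¹ ∙ g ≈ ε
  inverseˡ (a , x) = [n∸1]*m+m%n≡0%n r a ,≈ λ i → [n∸1]*m+m%n≡0%n t _

  inverseʳ : ∀ g → g ∙ g ⁻¹ ≈ ε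
  inverseʳ (a , x) = trans (cong (_% r) (+-comm a _)) ([n∸1]*m+m%n≡0%n r a) ,≈ λ i →
    trans (cong (λ u → (x i + (t ∸ 1) * u) % t) (rot-back i))
            (trans (cong (_% t) (+-comm (x i) _)) ([n∸1]*m+m%n≡0%n t (x i)))
    where
    rot-back : ∀ i → rot a (rot ((r ∸ 1) * a) x) i ≡ x i
    rot-back i = trans (rot-rot a _ x i)
                         (rot-≡0 x (trans (cong (_% r) (+-comm a _)) ([n∸1]*m+m%n≡0 a)) i)

  ⁻¹-cong : ∀ {g h} → g ≈ h → g ⁻¹ ≈ h ⁻¹
  ⁻¹-cong {a , x} {b , y} (p ,≈ q) = r-neg ,≈ λ i →
    %-cong-* {a = t ∸ 1} refl (trans (cong (_% t) (rot-cong x r-neg i)) (q _))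
    where
    r-neg : ((r ∸ 1) * a) % r ≡ ((r ∸ 1) * b) % r
    r-neg = %-cong-* {a = r ∸ 1} refl p

  group : Group 0ℓ 0ℓ
  group = record
    { Carrier = Element
    ; _≈_ = _≈_
    ; _∙_ = _∙_
    ; ε = ε
    ; _⁻¹ = _⁻¹
    ; isGroup = record
      { isMonoid = record
        { isSemigroup = record
          { isMagma = record
            { isEquivalence = record { refl = ≈-refl ; sym = ≈-sym ; trans = ≈-trans }
            ; ∙-cong = ∙-cong }
          ; assoc = assoc }
        ; identity = identityˡ , identityʳ }
      ; inverse = inverseˡ , inverseʳ
      ; ⁻¹-cong = ⁻¹-cong } }

  _≟_ : Decidable _≈_
  (a , x) ≟ (b , y) = map′ (λ (p , q) → p ,≈ q) (λ (p ,≈ q) → p , q)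
    ((a % r ℕ.≟ b % r) ×-dec all? (λ i → x i % t ℕ.≟ y i % t))

  encode : Element → Fin (r * t ^ r)
  encode (a , x) = combine (a mod r) (funToFin (λ i → x i mod t))

  decode : Fin (r * t ^ r) → Element
  decode j = toℕ (proj₁ (remQuot {r} (t ^ r) j)) , λ i → toℕ (finToFun (proj₂ (remQuot {r} (t ^ r) j)) i)

  encode-cong : ∀ {g h} → g ≈ h → encode g ≡ encode h
  encode-cong (p ,≈ q) = cong₂ combine (mod-cong p) (funToFin-cong (λ i → mod-cong (q i)))

  encode-decode : ∀ j → encode (decode j) ≡ j
  encode-decode j = trans
    (cong₂ combine (toℕ-mod-id _) (trans (funToFin-cong {r} (λ i → toℕ-mod-id _)) (funToFin-finToFin {r} {t} x)))
    (combine-remQuot {r} (t ^ r) j)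
    where x = proj₂ (remQuot {r} (t ^ r) j)

  decode-encode : ∀ g → decode (encode g) ≈ g
  decode-encode (a , x) =
    trans (cong (λ q → toℕ (proj₁ q) % r) rq) (trans (cong (_% r) (toℕ-mod a)) (m%n%n≡m%n a r)) ,≈ λ i →
    trans (cong (λ q → toℕ (finToFun (proj₂ q) i) % t) rq)
      (trans (cong (λ v → toℕ v % t) (finToFun-funToFin (λ i → x i mod t) i))
        (trans (cong (_% t) (toℕ-mod (x i))) (m%n%n≡m%n (x i) t)))
    where
    rq = remQuot-combine {r} {t ^ r} (a mod r) (funToFin (λ i → x i mod t))

  order : Inverse (Group.setoid group) (≡.setoid (Fin (r * t ^ r)))
  order = record
    { to = encode
    ; from = decode
    ; to-cong = encode-cong
    ; from-cong = λ { refl → ≈-refl }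
    ; inverse = (λ {j} p → trans (encode-cong p) (encode-decode j))
              , (λ { {g} refl → decode-encode g }) }

  setoid = Group.setoid group

  open SetoidMembership setoid public using (_∈_; _∉_)
  open SetoidUnique setoid public using (Unique)

  cayleyGraph : (S : List Element) → Unique S → ¬ ε ∈ S → (∀ {s} → s ∈ S → s ⁻¹ ∈ S) → CayleyGraph
  cayleyGraph S S-distinct ε∉S S-inv = record
    { G = group ; S = S ; S-distinct = S-distinct ; ε∉S = ε∉S ; S-inv = S-inv }

  Covers : ∀ {n} → (Fin n → Fin r) → Coords → Coords → Set
  Covers F x y = ∀ w → ¬ x w % t ≡ y w % t → ∃[ q ] F q ≡ w

  Sparse : ℕ → Element → Set
  Sparse n (_ , y) = ∃[ F ] Covers {n} F (λ _ → 0) y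

  covers-++ : ∀ {m n x y z} {F : Fin m → Fin r} {G : Fin n → Fin r} →
              Covers F x y → Covers G y z → Covers (F ++ᶠ G) x z
  covers-++ {m} {n} {x} {y} {z} {F} {G} F-xy G-yz w x≉z with x w % t ℕ.≟ y w % t
  ... | no x≉y = let q , Fq≡w = F-xy w x≉y in q ↑ˡ n , trans (lookup-++ˡ F G q) Fq≡w
  ... | yes x≈y = let q , Gq≡w = G-yz w (λ y≈z → x≉z (trans x≈y y≈z)) in m ↑ʳ q , trans (lookup-++ʳ F G q) Gq≡w

  [w+b]-b≡w : ∀ w b → w ≡ (toℕ ((toℕ w + b) mod r) + (r ∸ 1) * b) mod r
  [w+b]-b≡w w b = sym (begin
    (toℕ ((toℕ w + b) mod r) + (r ∸ 1) * b) mod r ≡⟨ mod-+ (toℕ w + b) _ ⟩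
    (toℕ w + b + (r ∸ 1) * b) mod r               ≡⟨ cong (_mod r) (+-assoc (toℕ w) b _) ⟩
    (toℕ w + (b + (r ∸ 1) * b)) mod r             ≡⟨ mod-cong (%-cong-+ {a = toℕ w} refl b+[r∸1]*b≡0) ⟩
    (toℕ w + 0) mod r                             ≡⟨ cong (_mod r) (+-identityʳ (toℕ w)) ⟩
    toℕ w mod r                                   ≡⟨ toℕ-mod-id w ⟩
    w                                             ∎)
    where
    open ≡.≡-Reasoning
    b+[r∸1]*b≡0 : (b + (r ∸ 1) * b) % r ≡ 0 % r
    b+[r∸1]*b≡0 = trans (cong (_% r) (+-comm b _)) ([n∸1]*m+m%n≡0%n r b)

  covers-rot : ∀ {n a y} {F : Fin n → Fin r} → Covers F (λ _ → 0) y →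
               Covers (λ q → (toℕ (F q) + (r ∸ 1) * a) mod r) (λ _ → 0) (rot a y)
  covers-rot {a = a} {F = F} cov w 0≉y =
    let q , Fq≡ = cov ((toℕ w + a) mod r) 0≉y in q , sym (subst (λ v → w ≡ (toℕ v + (r ∸ 1) * a) mod r) (sym Fq≡) ([w+b]-b≡w w a))

  sparse-resp : ∀ {n g h} → g ≈ h → Sparse n g → Sparse n h
  sparse-resp (_ ,≈ q) (F , cov) = F , λ w 0≉z → cov w (λ 0≈y → 0≉z (trans 0≈y (q w)))

  sparse-⁻¹ : ∀ {n g} → Sparse n g → Sparse n (g ⁻¹)
  sparse-⁻¹ {g = a , y} (F , cov) = _ , λ w 0≉[t∸1]y → covers-rot cov w λ 0≈y →
    0≉[t∸1]y (trans (cong (_% t) (sym (*-zeroʳ (t ∸ 1)))) (%-cong-* {a = t ∸ 1} refl 0≈y))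

  covers-∙ : ∀ {n} x a {s} → Sparse n s → ∃[ F ] Covers {n} F x (proj₂ ((a , x) ∙ s))
  covers-∙ x a {b , y} (F , cov) = _ , λ w x≉x+y → covers-rot cov w λ 0≈y →
    x≉x+y (trans (cong (_% t) (sym (+-identityʳ (x w)))) (%-cong-+ {a = x w} refl 0≈y))

  module _ {ℓ S} {S-distinct : Unique S} {ε∉S : ¬ ε ∈ S} {S-inv : ∀ {s} → s ∈ S → s ⁻¹ ∈ S}
           (S-sparse : ∀ {s} → s ∈ S → Sparse ℓ s) where

    open CayleyGraph (cayleyGraph S S-distinct ε∉S S-inv) using (Path; stay; step)

    path⇒covers : ∀ {n g h} → Path n g h → ∃[ F ] Covers {n * ℓ} F (proj₂ g) (proj₂ h)
    path⇒covers (stay g≈h) = (λ _ → 0 mod r) , λ w x≉y → ⊥-elim (x≉y (≈-coords g≈h w))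
    path⇒covers {g = a , x} (step {s = s} s∈S p) =
      let F , x~xs = covers-∙ x a {s} (S-sparse s∈S)
          G , xs~h = path⇒covers p
      in F ++ᶠ G , covers-++ x~xs xs~h

    ¬path-ε-ones : 1 < t → ∀ n → n * ℓ < r → ¬ Path n ε (0 , λ _ → 1)
    ¬path-ε-ones 1<t n n*ℓ<r p = <⇒≱ n*ℓ<r (surjection⇒≤ F λ w → covers w 0≉1)
      where
      F = proj₁ (path⇒covers p)
      covers = proj₂ (path⇒covers p)
      0≉1 : ¬ 0 % t ≡ 1 % t
      0≉1 0≈1 with () ← trans (sym (0%n≡0 t)) (trans 0≈1 (m<n⇒m%n≡m 1<t))

module Layout (k₂ ℓ m : ℕ) (m<ℓ : m < ℓ) where

  open ≡.≡-Reasoning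

  k₁ k r : ℕ
  k₁ = suc k₂
  k  = suc k₁
  r  = k₁ * ℓ + m

  long : ℕ
  long = m * k

  r≡long+short : r ≡ long + (ℓ ∸ m) * k₁
  r≡long+short = begin
    k₁ * ℓ + m                       ≡⟨ cong (λ u → k₁ * u + m) (sym (m+[n∸m]≡n (<⇒≤ m<ℓ))) ⟩
    k₁ * (m + (ℓ ∸ m)) + m           ≡⟨ cong (_+ m) (*-distribˡ-+ k₁ m (ℓ ∸ m)) ⟩
    k₁ * m + k₁ * (ℓ ∸ m) + m        ≡⟨ +-assoc (k₁ * m) _ m ⟩
    k₁ * m + (k₁ * (ℓ ∸ m) + m)      ≡⟨ cong (k₁ * m +_) (+-comm _ m) ⟩
    k₁ * m + (m + k₁ * (ℓ ∸ m))      ≡⟨ +-assoc (k₁ * m) m _ ⟨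
    k₁ * m + m + k₁ * (ℓ ∸ m)        ≡⟨ cong₂ _+_ (trans (+-comm (k₁ * m) m) (*-comm k m)) (*-comm k₁ (ℓ ∸ m)) ⟩
    long + (ℓ ∸ m) * k₁              ∎

  start : ℕ → ℕ
  start q with q <? m
  ... | yes _ = q * k
  ... | no _  = long + (q ∸ m) * k₁

  row : ℕ → ℕ
  row i with i <? long
  ... | yes _ = i / k
  ... | no _  = m + (i ∸ long) / k₁

  offset : ℕ → ℕ
  offset i with i <? long
  ... | yes _ = i % k
  ... | no _  = (i ∸ long) % k₁

  start-row+offset : ∀ i → i < r → start (row i) + offset i ≡ i
  start-row+offset i i<r with i <? long
  ... | yes i<long with i / k <? m
  ...   | yes _ = trans (+-comm (i / k * k) (i % k)) (sym (m≡m%n+[m/n]*n i k))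
  ...   | no ¬< = ⊥-elim (¬< (m<n*o⇒m/o<n i<long))
  start-row+offset i i<r | no i≮long with m + (i ∸ long) / k₁ <? m
  ... | yes < = ⊥-elim (m+n≮m m _ <)
  ... | no _  = begin
    long + (m + d / k₁ ∸ m) * k₁ + d % k₁  ≡⟨ cong (λ u → long + u * k₁ + d % k₁) (m+n∸m≡n m (d / k₁)) ⟩
    long + d / k₁ * k₁ + d % k₁            ≡⟨ +-assoc long _ _ ⟩
    long + (d / k₁ * k₁ + d % k₁)          ≡⟨ cong (long +_) (trans (+-comm (d / k₁ * k₁) (d % k₁)) (sym (m≡m%n+[m/n]*n d k₁))) ⟩
    long + d                               ≡⟨ m+[n∸m]≡n (≮⇒≥ i≮long) ⟩
    i                                      ∎
    where d = i ∸ long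

  row<ℓ : ∀ i → i < r → row i < ℓ
  row<ℓ i i<r with i <? long
  ... | yes i<long = <-trans (m<n*o⇒m/o<n i<long) m<ℓ
  ... | no i≮long  = subst (m + (i ∸ long) / k₁ <_) (m+[n∸m]≡n (<⇒≤ m<ℓ))
                       (+-monoʳ-< m (m<n*o⇒m/o<n d<))
    where
    d< : i ∸ long < (ℓ ∸ m) * k₁
    d< = +-cancelˡ-< long _ _ (≡.subst₂ _<_ (sym (m+[n∸m]≡n (≮⇒≥ i≮long))) r≡long+short i<r)

  offset<k : ∀ i → offset i < k
  offset<k i with i <? long
  ... | yes _ = m%n<n i k
  ... | no _  = <-trans (m%n<n (i ∸ long) k₁) (n<1+n k₁)

  offset≡k₁⇒row<m : ∀ i → offset i ≡ k₁ → row i < m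
  offset≡k₁⇒row<m i p with i <? long
  ... | yes i<long = m<n*o⇒m/o<n i<long
  ... | no _       = ⊥-elim (<-irrefl p (m%n<n (i ∸ long) k₁))

  start+offset : ∀ q j → q < ℓ → j < k → q < m ⊎ j < k₁ →
                 start q + j < r × row (start q + j) ≡ q × offset (start q + j) ≡ j
  start+offset q j q<ℓ j<k q<m⊎j<k₁ with q <? m
  start+offset q j q<ℓ j<k _ | yes q<m with q * k + j <? long
  ... | no ≮ = ⊥-elim (≮ <long)
    where
    <long : q * k + j < long
    <long = ≤-trans (+-monoʳ-< (q * k) j<k) (≤-trans (≤-reflexive (+-comm (q * k) k)) (*-monoˡ-≤ k q<m))
  ... | yes <long = ≤-trans <long (≤-trans (m≤m+n long _) (≤-reflexive (sym r≡long+short)))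
                  , q*n+j/n≡q q j k j<k , q*n+j%n≡j q j k j<k
  start+offset q j q<ℓ j<k (inj₁ q<m) | no q≮m = ⊥-elim (q≮m q<m)
  start+offset q j q<ℓ j<k (inj₂ j<k₁) | no q≮m with long + (q ∸ m) * k₁ + j <? long
  ... | yes < = ⊥-elim (m+n≮m long _ (≤-trans (≤-reflexive (cong suc (sym (+-assoc long _ j)))) <))
  ... | no _  = <r , row≡ , offset≡
    where
    d≡ : long + (q ∸ m) * k₁ + j ∸ long ≡ (q ∸ m) * k₁ + j
    d≡ = trans (cong (_∸ long) (+-assoc long _ j)) (m+n∸m≡n long _)
    row≡ : m + (long + (q ∸ m) * k₁ + j ∸ long) / k₁ ≡ q
    row≡ = trans (cong (λ u → m + u / k₁) d≡)
                 (trans (cong (m +_) (q*n+j/n≡q (q ∸ m) j k₁ j<k₁)) (m+[n∸m]≡n (≮⇒≥ q≮m)))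
    offset≡ : (long + (q ∸ m) * k₁ + j ∸ long) % k₁ ≡ j
    offset≡ = trans (cong (_% k₁) d≡) (q*n+j%n≡j (q ∸ m) j k₁ j<k₁)
    <r : long + (q ∸ m) * k₁ + j < r
    <r = subst (long + (q ∸ m) * k₁ + j <_) (sym r≡long+short)
      (≤-trans (≤-reflexive (trans (cong suc (+-assoc long _ j)) (sym (+-suc long _)))) (+-monoʳ-≤ long
        (≤-trans (+-monoʳ-< ((q ∸ m) * k₁) j<k₁)
          (≤-trans (≤-reflexive (+-comm _ k₁)) (*-monoˡ-≤ k₁ (∸-monoˡ-< q<ℓ (≮⇒≥ q≮m)))))))

  start-coords : ∀ q → q < ℓ → start q < r × row (start q) ≡ q × offset (start q) ≡ 0
  start-coords q q<ℓ =
    let <r , row≡ , offset≡ = start+offset q 0 q<ℓ (s≤s z≤n) (inj₂ (s≤s z≤n))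
        q+0≡q = +-identityʳ (start q)
    in subst (_< r) q+0≡q <r , subst (λ i → row i ≡ q) q+0≡q row≡ , subst (λ i → offset i ≡ 0) q+0≡q offset≡

module Construction (k₂ ℓ m t₂ : ℕ) (1≤m : 1 ≤ m) (m<ℓ : m < ℓ) where

  open Layout k₂ ℓ m m<ℓ public

  t : ℕ
  t = suc (suc t₂)

  3≤r : 3 ≤ r
  3≤r = +-mono-≤ (≤-trans (≤-trans (s≤s 1≤m) m<ℓ) (m≤m+n ℓ (k₂ * ℓ))) 1≤m

  instance
    r≢0 : NonZero r
    r≢0 = >-nonZero (≤-trans (s≤s z≤n) 3≤r)

  open Wreath r t public
  open Padding group _≟_ (Sparse ℓ) (λ {g} {h} → sparse-resp {ℓ} {g} {h}) (λ {g} → sparse-⁻¹ {ℓ} {g}) public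
  open GroupProperties group using (⁻¹-involutive)

  0<r : 0 < r
  0<r = ≤-trans (s≤s z≤n) 3≤r

  r∸1<r : r ∸ 1 < r
  r∸1<r = ∸-monoʳ-< {r} {1} {0} (s≤s z≤n) 0<r

  1≤r∸1 : 1 ≤ r ∸ 1
  1≤r∸1 = ∸-monoˡ-≤ 1 (≤-trans (s≤s (s≤s z≤n)) 3≤r)

  r∸2<r : r ∸ 2 < r
  r∸2<r = ∸-monoʳ-< {r} {2} {0} (s≤s z≤n) (≤-trans (s≤s (s≤s z≤n)) 3≤r)

  r∸2≡1+r∸3 : r ∸ 2 ≡ suc (r ∸ 3)
  r∸2≡1+r∸3 = +-∸-assoc 1 {r} {3} 3≤r

  r∸c-bounds : ∀ {c} → 1 ≤ c → c ≤ r ∸ 2 → 2 ≤ r ∸ c × r ∸ c < r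
  r∸c-bounds {c} 1≤c c≤r∸2 =
    m+n≤o⇒m≤o∸n 2 (≤-trans (≤-reflexive (+-comm 2 c)) (m≤o∸n⇒m+n≤o c (≤-trans (s≤s (s≤s z≤n)) 3≤r) c≤r∸2)) ,
    ∸-monoʳ-< {r} {c} {0} 1≤c (≤-trans c≤r∸2 (m∸n≤m r 2))

  [r∸1]*c≈r∸c : ∀ {c} → 1 ≤ c → c ≤ r ∸ 2 → ((r ∸ 1) * c) % r ≡ (r ∸ c) % r
  [r∸1]*c≈r∸c 1≤c c≤r∸2 = [n∸1]*m%n≡[n∸m]%n r 1≤c (≤-trans c≤r∸2 (m∸n≤m r 2))

  0≉shift : ∀ {c} → 1 ≤ c → c < r → ¬ 0 % r ≡ c % r
  0≉shift 1≤c c<r 0≈c = <⇒≢ 1≤c (%-injective-< 0<r c<r 0≈c)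

  shift≉ε : ∀ {c y} → 1 ≤ c → c < r → ¬ (c , y) ≈ ε
  shift≉ε 1≤c c<r c≈ε = 0≉shift 1≤c c<r (sym (≈-shift c≈ε))

  rowOf offsetOf : Fin r → ℕ
  rowOf w = row (toℕ w)
  offsetOf w = offset (toℕ w)

  cell : ℕ → ℕ → Fin r
  cell q j = (start q + j) mod r

  cell-rowOf : ∀ {w j} → offsetOf w ≡ j → cell (rowOf w) j ≡ w
  cell-rowOf {w} refl = trans (cong (_mod r) (start-row+offset (toℕ w) (toℕ<n w))) (toℕ-mod-id w)

  Cell : ℕ → ℕ → Set
  Cell q j = q < ℓ × j < k × (q < m ⊎ j < k₁)

  cell-coords : ∀ {q j} → Cell q j → toℕ (cell q j) ≡ start q + j × rowOf (cell q j) ≡ q × offsetOf (cell q j) ≡ j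
  cell-coords {q} {j} (q<ℓ , j<k , long⊎j<k₁) = toℕ≡ , trans (cong row toℕ≡) row≡ , trans (cong offset toℕ≡) offset≡
    where
    facts = start+offset q j q<ℓ j<k long⊎j<k₁
    toℕ≡ : toℕ (cell q j) ≡ start q + j
    toℕ≡ = trans (toℕ-mod (start q + j)) (m<n⇒m%n≡m (proj₁ facts))
    row≡ : row (start q + j) ≡ q
    row≡ = proj₁ (proj₂ facts)
    offset≡ : offset (start q + j) ≡ j
    offset≡ = proj₂ (proj₂ facts)

  place : ∀ {n} → (Fin n → ℕ) → ℕ → Coords
  place {n} v j w with offsetOf w ℕ.≟ j | rowOf w <? n
  ... | yes _ | yes q<n = v (fromℕ< q<n)
  ... | _     | _       = 0

  SupportedAt : ℕ → ℕ → Coords → Set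
  SupportedAt n j y = ∀ w → ¬ y w % t ≡ 0 → offsetOf w ≡ j × rowOf w < n

  place-supported : ∀ {n} (v : Fin n → ℕ) j → SupportedAt n j (place v j)
  place-supported {n} v j w v≢0 with offsetOf w ℕ.≟ j | rowOf w <? n
  ... | yes o≡j | yes q<n = o≡j , q<n
  ... | yes _   | no _    = ⊥-elim (v≢0 refl)
  ... | no _    | _       = ⊥-elim (v≢0 refl)

  place-cell : ∀ {n q j} (v : Fin n → ℕ) (q<n : q < n) → Cell q j → place v j (cell q j) ≡ v (fromℕ< q<n)
  place-cell {n} {q} {j} v q<n c with offsetOf (cell q j) ℕ.≟ j | rowOf (cell q j) <? n
  ... | yes _ | yes q′<n = cong v (fromℕ<-cong _ _ (proj₁ (proj₂ (cell-coords c))) q′<n q<n)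
  ... | yes _ | no ≮n    = ⊥-elim (≮n (subst (_< n) (sym (proj₁ (proj₂ (cell-coords c)))) q<n))
  ... | no ≢j | _        = ⊥-elim (≢j (proj₂ (proj₂ (cell-coords c))))

  place-restrict : ∀ {n j y} → SupportedAt n j y → ∀ w → place {n} (λ q → y (cell (toℕ q) j)) j w % t ≡ y w % t
  place-restrict {n} {j} {y} y-supp w with offsetOf w ℕ.≟ j | rowOf w <? n | y w % t ℕ.≟ 0
  ... | yes o≡j | yes q<n | _ = trans (cong (λ q → y (cell q j) % t) (toℕ-fromℕ< q<n)) (cong (λ v → y v % t) (cell-rowOf o≡j))
  ... | yes _   | no _    | yes y≡0 = sym y≡0
  ... | yes _   | no ≮n   | no y≢0  = ⊥-elim (≮n (proj₂ (y-supp w y≢0)))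
  ... | no _    | _       | yes y≡0 = sym y≡0
  ... | no ≢j   | _       | no y≢0  = ⊥-elim (≢j (proj₁ (y-supp w y≢0)))

  place-cong : ∀ {n} {v v′ : Fin n → ℕ} → (∀ q → v q % t ≡ v′ q % t) → ∀ j → place v j ≋ place v′ j
  place-cong {n} v≋v′ j w with offsetOf w ℕ.≟ j | rowOf w <? n
  ... | yes _ | yes q<n = v≋v′ (fromℕ< q<n)
  ... | yes _ | no _    = refl
  ... | no _  | _       = refl

  supported⇒sparse : ∀ {n j y} a → SupportedAt n j y → n ≤ ℓ → Sparse ℓ (a , y)
  supported⇒sparse {j = j} _ y-supp n≤ℓ = (λ q → cell (toℕ q) j) , λ w 0≢y →
    let o≡j , q<n = y-supp w (λ y≡0 → 0≢y (sym y≡0))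
        q<ℓ = <-≤-trans q<n n≤ℓ
    in fromℕ< q<ℓ , trans (cong (λ q → cell q j) (toℕ-fromℕ< q<ℓ)) (cell-rowOf o≡j)

  digits : ∀ {p} → Fin (t ^ p) → Fin p → ℕ
  digits {p} u q = toℕ (finToFun {t} {p} u q)

  code : ∀ {p} → (Fin p → ℕ) → Fin (t ^ p)
  code y = funToFin (λ q → y q mod t)

  digits-code : ∀ {p} (y : Fin p → ℕ) q → digits (code y) q ≡ y q % t
  digits-code y q = trans (cong toℕ (finToFun-funToFin (λ q → y q mod t) q)) (toℕ-mod (y q))

  digits-injective : ∀ {p} {u u′ : Fin (t ^ p)} → (∀ q → digits u q % t ≡ digits u′ q % t) → u ≡ u′
  digits-injective {p} {u} {u′} p≋ = begin
    u                                  ≡⟨ funToFin-finToFin {p} {t} u ⟨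
    funToFin (finToFun {t} {p} u)      ≡⟨ funToFin-cong {p} {t} {finToFun u} {finToFun u′} finToFun≡ ⟩
    funToFin (finToFun {t} {p} u′)     ≡⟨ funToFin-finToFin {p} {t} u′ ⟩
    u′                                 ∎
    where
    open ≡.≡-Reasoning
    finToFun≡ : ∀ q → finToFun {t} {p} u q ≡ finToFun u′ q
    finToFun≡ q = toℕ-injective (%-injective-< (toℕ<n (finToFun {t} {p} u q)) (toℕ<n (finToFun {t} {p} u′ q)) (p≋ q))

  digits≡0⇒≡0 : ∀ {p} (u : Fin (t ^ p)) → (∀ q → digits u q ≡ 0) → toℕ u ≡ 0
  digits≡0⇒≡0 {p} u digits≡0 = trans (cong toℕ (sym (funToFin-finToFin {p} {t} u))) (toℕ-funToFin≡0 (finToFun {t} {p} u) digits≡0)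

  ≡0⇒digits≡0 : ∀ {p} (u : Fin (t ^ p)) → toℕ u ≡ 0 → ∀ q → digits u q ≡ 0
  ≡0⇒digits≡0 {p} u u≡0 = toℕ-funToFin≡0⁻¹ (finToFun {t} {p} u) (trans (cong toℕ (funToFin-finToFin {p} {t} u)) u≡0)

  spread : ∀ {p} → ℕ → Fin (t ^ p) → Coords
  spread {p} j u = place (digits {p} u) j

  spread-supported : ∀ {p} j (u : Fin (t ^ p)) → SupportedAt p j (spread j u)
  spread-supported {p} j u = place-supported (digits {p} u) j

  spread-code : ∀ {p j y} → SupportedAt p j y → spread j (code {p} (λ q → y (cell (toℕ q) j))) ≋ y
  spread-code {p} {j} {y} y-supp w = trans (place-cong {p} {digits {p} (code y′)} {y′} digits≋ j w) (place-restrict {p} {j} {y} y-supp w)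
    where
    y′ : Fin p → ℕ
    y′ q = y (cell (toℕ q) j)
    digits≋ : ∀ q → digits {p} (code y′) q % t ≡ y′ q % t
    digits≋ q = trans (cong (_% t) (digits-code y′ q)) (m%n%n≡m%n (y′ q) t)

  spread-cell : ∀ {p j} (u : Fin (t ^ p)) q → Cell (toℕ q) j → spread j u (cell (toℕ q) j) ≡ digits u q
  spread-cell {p} u q c = trans (place-cell (digits {p} u) (toℕ<n q) c) (cong (digits {p} u) (fromℕ<-toℕ q (toℕ<n q)))

  spread-injective : ∀ {p j} → (∀ (q : Fin p) → Cell (toℕ q) j) →
                     ∀ {u u′ : Fin (t ^ p)} → spread j u ≋ spread j u′ → u ≡ u′
  spread-injective cells {u} {u′} u≋u′ = digits-injective λ q →
    ≡.subst₂ (λ a b → a % t ≡ b % t) (spread-cell u q (cells q)) (spread-cell u′ q (cells q)) (u≋u′ _)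

  spread-nonzero : ∀ {p j} → (∀ (q : Fin p) → Cell (toℕ q) j) →
                   ∀ (u : Fin (t ^ p)) → ¬ toℕ u ≡ 0 → ∃[ w ] ¬ spread j u w % t ≡ 0
  spread-nonzero {p} {j} cells u u≢0 with any? (λ q → ¬? (digits {p} u q ℕ.≟ 0))
  ... | yes (q , dq≢0) = cell (toℕ q) j , λ s≡0 →
    dq≢0 (trans (sym (m<n⇒m%n≡m (toℕ<n (finToFun {t} {p} u q)))) (trans (cong (_% t) (sym (spread-cell u q (cells q)))) s≡0))
  ... | no ∄ = ⊥-elim (u≢0 (digits≡0⇒≡0 u λ q → decidable-stable (digits {p} u q ℕ.≟ 0) λ dq≢0 → ∄ (q , dq≢0)))

  spread-zero : ∀ {p} j (u : Fin (t ^ p)) → toℕ u ≡ 0 → ∀ w → spread j u w % t ≡ 0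
  spread-zero {p} j u u≡0 w =
    trans (place-cong {p} {digits {p} u} {λ _ → 0} (λ q → cong (_% t) (≡0⇒digits≡0 u u≡0 q)) j w) (place-0 w)
    where
    place-0 : ∀ w → place {p} (λ _ → 0) j w % t ≡ 0
    place-0 w with offsetOf w ℕ.≟ j | rowOf w <? p
    ... | yes _ | yes _ = refl
    ... | yes _ | no _  = refl
    ... | no _  | _     = refl

  NonZeroCode : ∀ {n} → Fin n → Set
  NonZeroCode u = ¬ toℕ u ≡ 0

  A : Fin (t ^ ℓ) → Element
  A v = r ∸ 1 , spread {ℓ} 0 v

  L : ℕ → Fin (t ^ m) → Element
  L c u = c , spread {m} 0 u

  Z : ℕ → Element
  Z c = c , λ _ → 0

  A⁻¹ : Fin (t ^ ℓ) → Element
  A⁻¹ v = A v ⁻¹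

  L⁻¹ : ℕ → Fin (t ^ m) → Element
  L⁻¹ c u = L c u ⁻¹

  data IsGenerator : Element → Set where
    A-gen   : ∀ v → IsGenerator (A v)
    A⁻¹-gen : ∀ v → IsGenerator (A⁻¹ v)
    L-gen   : ∀ {c u} → c ≤ r ∸ 2 → NonZeroCode u → IsGenerator (L c u)
    L⁻¹-gen : ∀ {c u} → 1 ≤ c → c ≤ r ∸ 2 → NonZeroCode u → IsGenerator (L⁻¹ c u)
    Z-gen   : ∀ {c} → 2 ≤ c → c ≤ r ∸ 2 → IsGenerator (Z c)

  codes : List (Fin (t ^ ℓ))
  codes = allFin (t ^ ℓ)

  L-indices L⁻¹-indices : List (ℕ × Fin (t ^ m))
  L-indices   = cartesianProduct (upTo (r ∸ 1)) (nonzeroFins (t ^ m))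
  L⁻¹-indices = cartesianProduct (applyUpTo suc (r ∸ 2)) (nonzeroFins (t ^ m))

  generators : List Element
  generators = map A codes ++ map A⁻¹ codes
            ++ map (uncurry L) L-indices ++ map (uncurry L⁻¹) L⁻¹-indices
            ++ map Z (applyUpTo (2 +_) (r ∸ 3))

  module _ {I : Set} (φ : I → Element) where

    ∈-map⁺ : ∀ {i is x} → i ∈ₚ is → x ≈ φ i → x ∈ map φ is
    ∈-map⁺ i∈ x≈φi = ∈-resp-≈ (setoid) (≈-sym x≈φi)
      (SetoidMembershipProperties.∈-map⁺ (≡.setoid I) (setoid) (λ { refl → ≈-refl }) i∈)

    ∈-map⁻ : ∀ {is x} → x ∈ map φ is → ∃[ i ] i ∈ₚ is × x ≈ φ i
    ∈-map⁻ = SetoidMembershipProperties.∈-map⁻ (≡.setoid I) (setoid)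

  GeneratorView : Element → Set
  GeneratorView x = ∃[ g ] IsGenerator g × x ≈ g

  private
    view-A : ∀ {x} → x ∈ map A codes → GeneratorView x
    view-A x∈ = let v , _ , x≈ = ∈-map⁻ A x∈ in A v , A-gen v , x≈

    view-A⁻¹ : ∀ {x} → x ∈ map A⁻¹ codes → GeneratorView x
    view-A⁻¹ x∈ = let v , _ , x≈ = ∈-map⁻ A⁻¹ x∈ in A⁻¹ v , A⁻¹-gen v , x≈

    view-L : ∀ {x} → x ∈ map (uncurry L) L-indices → GeneratorView x
    view-L x∈ =
      let (c , u) , cu∈ , x≈ = ∈-map⁻ (uncurry L) x∈
          c∈ , u∈ = ∈-cartesianProduct⁻ (upTo (r ∸ 1)) _ cu∈
      in L c u , L-gen (≤-trans (∸-monoˡ-≤ 1 (∈-upTo⁻ c∈)) (≤-reflexive (∸-+-assoc r 1 1))) (∈-nonzeroFins⁻ u∈) , x≈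

    view-L⁻¹ : ∀ {x} → x ∈ map (uncurry L⁻¹) L⁻¹-indices → GeneratorView x
    view-L⁻¹ x∈ =
      let (c , u) , cu∈ , x≈ = ∈-map⁻ (uncurry L⁻¹) x∈
          c∈ , u∈ = ∈-cartesianProduct⁻ (applyUpTo suc (r ∸ 2)) _ cu∈
          i , i< , c≡ = ∈-applyUpTo⁻ suc c∈
      in L⁻¹ c u , L⁻¹-gen (subst (1 ≤_) (sym c≡) (s≤s z≤n)) (subst (_≤ r ∸ 2) (sym c≡) i<) (∈-nonzeroFins⁻ u∈) , x≈

    view-Z : ∀ {x} → x ∈ map Z (applyUpTo (2 +_) (r ∸ 3)) → GeneratorView x
    view-Z x∈ =
      let c , c∈ , x≈ = ∈-map⁻ Z x∈
          i , i< , c≡ = ∈-applyUpTo⁻ (2 +_) c∈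
      in Z c , Z-gen (subst (2 ≤_) (sym c≡) (s≤s (s≤s z≤n)))
                     (subst (_≤ r ∸ 2) (sym c≡) (subst (2 + i ≤_) (sym r∸2≡1+r∸3) (s≤s i<))) , x≈

  ∈-generators⁻ : ∀ {x} → x ∈ generators → GeneratorView x
  ∈-generators⁻ x∈ =
    [ view-A , [ view-A⁻¹ , [ view-L , [ view-L⁻¹ , view-Z ]′ ∘ split ]′ ∘ split ]′ ∘ split ]′ (split x∈)
    where
    split : ∀ {x xs ys} → x ∈ xs ++ ys → x ∈ xs ⊎ x ∈ ys
    split = ∈-++⁻ setoid _

  ∈-generators⁺ : ∀ {g x} → IsGenerator g → x ≈ g → x ∈ generators
  ∈-generators⁺ (A-gen v) x≈ = ∈-++⁺ˡ setoid (∈-map⁺ A (∈-allFin v) x≈)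
  ∈-generators⁺ (A⁻¹-gen v) x≈ = ∈-++⁺ʳ setoid (map A codes) (∈-++⁺ˡ setoid (∈-map⁺ A⁻¹ (∈-allFin v) x≈))
  ∈-generators⁺ (L-gen {c} c≤r∸2 u≢0) x≈ = ∈-++⁺ʳ setoid (map A codes) (∈-++⁺ʳ setoid (map A⁻¹ codes) (∈-++⁺ˡ setoid
    (∈-map⁺ (uncurry L) (∈-cartesianProduct⁺ (∈-upTo⁺ c<r∸1) (∈-nonzeroFins⁺ u≢0)) x≈)))
    where
    c<r∸1 : c < r ∸ 1
    c<r∸1 = ≤-trans (s≤s c≤r∸2) (≤-reflexive (sym (+-∸-assoc 1 {r} {2} (≤-trans (s≤s (s≤s z≤n)) 3≤r))))
  ∈-generators⁺ (L⁻¹-gen {suc c} (s≤s _) c<r∸2 u≢0) x≈ = ∈-++⁺ʳ setoid (map A codes) (∈-++⁺ʳ setoid (map A⁻¹ codes)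
    (∈-++⁺ʳ setoid (map (uncurry L) L-indices) (∈-++⁺ˡ setoid
      (∈-map⁺ (uncurry L⁻¹) (∈-cartesianProduct⁺ (∈-applyUpTo⁺ suc c<r∸2) (∈-nonzeroFins⁺ u≢0)) x≈))))
  ∈-generators⁺ (Z-gen {suc (suc c)} (s≤s (s≤s _)) c+2≤r∸2) x≈ = ∈-++⁺ʳ setoid (map A codes) (∈-++⁺ʳ setoid (map A⁻¹ codes)
    (∈-++⁺ʳ setoid (map (uncurry L) L-indices) (∈-++⁺ʳ setoid (map (uncurry L⁻¹) L⁻¹-indices)
      (∈-map⁺ Z (∈-applyUpTo⁺ (2 +_) (ℕ.s≤s⁻¹ (subst (suc (suc c) ≤_) r∸2≡1+r∸3 c+2≤r∸2))) x≈))))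

  row-starts : ∀ {p} → p ≤ ℓ → ∀ (q : Fin p) → Cell (toℕ q) 0
  row-starts p≤ℓ q = <-≤-trans (toℕ<n q) p≤ℓ , s≤s z≤n , inj₂ (s≤s z≤n)

  L≉ε : ∀ {c u} → NonZeroCode u → ¬ L c u ≈ ε
  L≉ε {u = u} u≢0 Lcu≈ε = let w , s≢0 = spread-nonzero (row-starts (<⇒≤ m<ℓ)) u u≢0 in s≢0 (≈-coords Lcu≈ε w)

  generator≉ε : ∀ {g} → IsGenerator g → ¬ g ≈ ε
  generator≉ε (A-gen v)                 = shift≉ε 1≤r∸1 r∸1<r
  generator≉ε (A⁻¹-gen v)               = generator≉ε (A-gen v) ∘ ⁻¹≈ε⇒≈ε
  generator≉ε (L-gen _ u≢0)             = L≉ε u≢0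
  generator≉ε (L⁻¹-gen _ _ u≢0)         = L≉ε u≢0 ∘ ⁻¹≈ε⇒≈ε
  generator≉ε (Z-gen 2≤c c≤r∸2)         = shift≉ε (≤-trans (s≤s z≤n) 2≤c) (≤-<-trans c≤r∸2 r∸2<r)

  generator-sparse : ∀ {g} → IsGenerator g → Sparse ℓ g
  generator-sparse (A-gen v)           = supported⇒sparse {y = spread {ℓ} 0 v} (r ∸ 1) (spread-supported 0 v) ≤-refl
  generator-sparse (A⁻¹-gen v)         = sparse-⁻¹ {g = A v} (generator-sparse (A-gen v))
  generator-sparse (L-gen {c} {u} _ _) = supported⇒sparse {y = spread {m} 0 u} c (spread-supported 0 u) (<⇒≤ m<ℓ)
  generator-sparse (L⁻¹-gen {c} {u} _ c≤r∸2 u≢0) = sparse-⁻¹ {g = L c u} (generator-sparse (L-gen c≤r∸2 u≢0))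
  generator-sparse (Z-gen _ _)       = (λ _ → cell 0 0) , λ _ 0≢0 → ⊥-elim (0≢0 refl)

  -- (L 0 u) ⁻¹ has coordinates -(spread u), again spread along the row starts.
  L0⁻¹≈L0 : ∀ {u} → NonZeroCode u → ∃[ u′ ] NonZeroCode u′ × L 0 u ⁻¹ ≈ L 0 u′
  L0⁻¹≈L0 {u} u≢0 = u′ , u′≢0 , L0u⁻¹≈L0u′
    where
    y : Coords
    y w = (t ∸ 1) * spread {m} 0 u w
    y-supp : SupportedAt m 0 y
    y-supp w y≢0 = spread-supported {m} 0 u w λ s≡0 →
      y≢0 (trans (%-cong-* {t} {t ∸ 1} {t ∸ 1} {spread {m} 0 u w} {0} refl s≡0) (cong (_% t) (*-zeroʳ (t ∸ 1))))
    u′ : Fin (t ^ m)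
    u′ = code {m} (λ q → y (cell (toℕ q) 0))
    L0u⁻¹≈L0u′ : L 0 u ⁻¹ ≈ L 0 u′
    L0u⁻¹≈L0u′ = cong (_% r) (*-zeroʳ (r ∸ 1)) ,≈ λ w →
      trans (cong (λ v → ((t ∸ 1) * v) % t) (rot-≡0 (spread {m} 0 u) (trans (cong (_% r) (*-zeroʳ (r ∸ 1))) (0%n≡0 r)) w))
            (sym (spread-code {m} {0} {y} y-supp w))
    u′≢0 : NonZeroCode u′
    u′≢0 u′≡0 = L≉ε u≢0 (⁻¹≈ε⇒≈ε (≈-trans L0u⁻¹≈L0u′ (refl ,≈ spread-zero {m} 0 u′ u′≡0)))

  generator-⁻¹ : ∀ {g} → IsGenerator g → GeneratorView (g ⁻¹)
  generator-⁻¹ (A-gen v)   = A⁻¹ v , A⁻¹-gen v , ≈-refl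
  generator-⁻¹ (A⁻¹-gen v) = A v , A-gen v , ⁻¹-involutive (A v)
  generator-⁻¹ (L-gen {zero} _ u≢0) = let u′ , u′≢0 , ≈u′ = L0⁻¹≈L0 u≢0 in L 0 u′ , L-gen z≤n u′≢0 , ≈u′
  generator-⁻¹ (L-gen {suc c} {u} c<r∸2 u≢0) = L⁻¹ (suc c) u , L⁻¹-gen (s≤s z≤n) c<r∸2 u≢0 , ≈-refl
  generator-⁻¹ (L⁻¹-gen {c} {u} _ c≤r∸2 u≢0) = L c u , L-gen c≤r∸2 u≢0 , ⁻¹-involutive (L c u)
  generator-⁻¹ (Z-gen {c} 2≤c c≤r∸2) =
    Z (r ∸ c) , Z-gen (proj₁ (r∸c-bounds 1≤c c≤r∸2)) (∸-monoʳ-≤ r 2≤c) ,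
    ([r∸1]*c≈r∸c 1≤c c≤r∸2 ,≈ λ w → cong (_% t) (*-zeroʳ (t ∸ 1)))
    where 1≤c = ≤-trans (s≤s z≤n) 2≤c

  generators-⁻¹-closed : ∀ {x} → x ∈ generators → x ⁻¹ ∈ generators
  generators-⁻¹-closed x∈ =
    let g , g-gen , x≈g = ∈-generators⁻ x∈
        g′ , g′-gen , g⁻¹≈g′ = generator-⁻¹ g-gen
    in ∈-generators⁺ g′-gen (≈-trans (⁻¹-cong x≈g) g⁻¹≈g′)

  ε∉generators : ε ∉ generators
  ε∉generators ε∈ = let g , g-gen , ε≈g = ∈-generators⁻ ε∈ in generator≉ε g-gen (≈-sym ε≈g)

  generators-sparse : ∀ {x} → x ∈ generators → Sparse ℓ x
  generators-sparse x∈ = let g , g-gen , x≈g = ∈-generators⁻ x∈ in sparse-resp (≈-sym x≈g) (generator-sparse g-gen)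

  r₃ T : ℕ
  r₃ = r ∸ 3
  T  = t ^ m ∸ 1

  r≡3+r₃ : r ≡ 3 + r₃
  r≡3+r₃ = sym (m+[n∸m]≡n 3≤r)

  t^m≡1+T : t ^ m ≡ suc T
  t^m≡1+T = sym (m+[n∸m]≡n (m^n>0 t m))

  length-generators : length generators ≡ 2 * t ^ ℓ + (3 + 2 * r₃) * T + r₃
  length-generators = begin
    length generators
      ≡⟨ length-++ (map A codes) ⟩
    length (map A codes) + length (map A⁻¹ codes ++ _)
      ≡⟨ cong₂ _+_ |codes| (length-++ (map A⁻¹ codes)) ⟩
    N + (length (map A⁻¹ codes) + length (map (uncurry L) L-indices ++ _))
      ≡⟨ cong (N +_) (cong₂ _+_ |codes| (length-++ (map (uncurry L) L-indices))) ⟩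
    N + (N + (length (map (uncurry L) L-indices) + length (map (uncurry L⁻¹) L⁻¹-indices ++ _)))
      ≡⟨ cong (λ x → N + (N + x)) (cong₂ _+_ |L| (length-++ (map (uncurry L⁻¹) L⁻¹-indices))) ⟩
    N + (N + ((r ∸ 1) * T + (length (map (uncurry L⁻¹) L⁻¹-indices) + length (map Z (applyUpTo (2 +_) (r ∸ 3))))))
      ≡⟨ cong (λ x → N + (N + ((r ∸ 1) * T + x))) (cong₂ _+_ |L⁻¹| |Z|) ⟩
    N + (N + ((r ∸ 1) * T + ((r ∸ 2) * T + (r ∸ 3))))
      ≡⟨ cong (λ r′ → N + (N + ((r′ ∸ 1) * T + ((r′ ∸ 2) * T + (r′ ∸ 3))))) r≡3+r₃ ⟩
    N + (N + ((2 + r₃) * T + ((1 + r₃) * T + r₃)))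
      ≡⟨ solve 3 (λ N T r₃ → N :+ (N :+ ((con 2 :+ r₃) :* T :+ ((con 1 :+ r₃) :* T :+ r₃)))
                             := con 2 :* N :+ (con 3 :+ con 2 :* r₃) :* T :+ r₃) refl N T r₃ ⟩
    2 * N + (3 + 2 * r₃) * T + r₃ ∎
    where
    open ≡.≡-Reasoning
    open +-*-Solver
    N = t ^ ℓ
    |codes| : ∀ {f : Fin (t ^ ℓ) → Element} → length (map f codes) ≡ N
    |codes| {f} = trans (length-map f codes) (length-tabulate (λ i → i))
    |L| : length (map (uncurry L) L-indices) ≡ (r ∸ 1) * T
    |L| = trans (length-map _ L-indices) (trans (length-cartesianProduct (upTo (r ∸ 1)) _)
            (cong₂ _*_ (length-upTo (r ∸ 1)) (length-nonzeroFins (t ^ m))))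
    |L⁻¹| : length (map (uncurry L⁻¹) L⁻¹-indices) ≡ (r ∸ 2) * T
    |L⁻¹| = trans (length-map _ L⁻¹-indices) (trans (length-cartesianProduct (applyUpTo suc (r ∸ 2)) _)
              (cong₂ _*_ (length-applyUpTo suc (r ∸ 2)) (length-nonzeroFins (t ^ m))))
    |Z| : length (map Z (applyUpTo (2 +_) (r ∸ 3))) ≡ r ∸ 3
    |Z| = trans (length-map Z (applyUpTo (2 +_) (r ∸ 3))) (length-applyUpTo (2 +_) (r ∸ 3))

  D : ℕ
  D = 2 * t ^ ℓ + (2 * r ∸ 3) * t ^ m ∸ r

  D≡ : D ≡ 2 * t ^ ℓ + (3 + 2 * r₃) * T + r₃
  D≡ = begin
    2 * N + (2 * r ∸ 3) * t ^ m ∸ r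
      ≡⟨ cong₂ (λ r′ x → 2 * N + (2 * r′ ∸ 3) * x ∸ r′) r≡3+r₃ t^m≡1+T ⟩
    2 * N + (2 * (3 + r₃) ∸ 3) * suc T ∸ (3 + r₃)
      ≡⟨ cong (λ x → 2 * N + x * suc T ∸ (3 + r₃)) 2[3+r₃]∸3≡ ⟩
    2 * N + (3 + 2 * r₃) * suc T ∸ (3 + r₃)
      ≡⟨ cong (_∸ (3 + r₃)) (solve 3 (λ N T r₃ → con 2 :* N :+ (con 3 :+ con 2 :* r₃) :* (con 1 :+ T)
                                           := con 2 :* N :+ (con 3 :+ con 2 :* r₃) :* T :+ r₃ :+ (con 3 :+ r₃)) refl N T r₃) ⟩
    2 * N + (3 + 2 * r₃) * T + r₃ + (3 + r₃) ∸ (3 + r₃)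
      ≡⟨ m+n∸n≡m _ (3 + r₃) ⟩
    2 * N + (3 + 2 * r₃) * T + r₃ ∎
    where
    open ≡.≡-Reasoning
    open +-*-Solver
    N = t ^ ℓ
    2[3+r₃]∸3≡ : 2 * (3 + r₃) ∸ 3 ≡ 3 + 2 * r₃
    2[3+r₃]∸3≡ = trans (cong (_∸ 3) (solve 1 (λ x → con 2 :* (con 3 :+ x) := con 3 :+ (con 3 :+ con 2 :* x)) refl r₃))
                       (m+n∸m≡n 3 (3 + 2 * r₃))

  pool-A : Fin (r ∸ 1) × Fin (t ^ ℓ) → Element
  pool-A (c , v) = suc (toℕ c) , spread {ℓ} 0 v

  pool-B : Fin r × Fin (t ^ m) → Element
  pool-B (c , u) = toℕ c , spread {m} 1 u

  pool-A-indices : List (Fin (r ∸ 1) × Fin (t ^ ℓ))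
  pool-A-indices = cartesianProduct (allFin (r ∸ 1)) codes

  pool-B-indices : List (Fin r × Fin (t ^ m))
  pool-B-indices = cartesianProduct (allFin r) (nonzeroFins (t ^ m))

  pool : List Element
  pool = map pool-A pool-A-indices ++ map pool-B pool-B-indices

  suc-toℕ<r : ∀ (c : Fin (r ∸ 1)) → suc (toℕ c) < r
  suc-toℕ<r c = ≤-trans (s≤s (toℕ<n c)) (≤-reflexive (m+[n∸m]≡n {1} {r} (≤-trans (s≤s z≤n) 3≤r)))

  second-cells : ∀ (q : Fin m) → Cell (toℕ q) 1
  second-cells q = <-trans (toℕ<n q) m<ℓ , s≤s (s≤s z≤n) , inj₁ (toℕ<n q)

  pool-A-injective : ∀ {a b} → pool-A a ≈ pool-A b → a ≡ b
  pool-A-injective {c , v} {c′ , v′} (c≈c′ ,≈ v≋v′) =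
    cong₂ _,_ (toℕ-injective (suc-injective (%-injective-< (suc-toℕ<r c) (suc-toℕ<r c′) c≈c′)))
              (spread-injective (row-starts ≤-refl) v≋v′)

  pool-B-injective : ∀ {a b} → pool-B a ≈ pool-B b → a ≡ b
  pool-B-injective {c , u} {c′ , u′} (c≈c′ ,≈ u≋u′) =
    cong₂ _,_ (toℕ-injective (%-injective-< (toℕ<n c) (toℕ<n c′) c≈c′)) (spread-injective second-cells u≋u′)

  pool-A≉pool-B : ∀ {a c u} → NonZeroCode u → ¬ pool-A a ≈ pool-B (c , u)
  pool-A≉pool-B {c , v} {u = u} u≢0 (_ ,≈ v≋u) =
    let w , u-w≢0 = spread-nonzero second-cells u u≢0
        offset≡1 = proj₁ (spread-supported 1 u w u-w≢0)
        v-w≢0 = λ v-w≡0 → u-w≢0 (trans (sym (v≋u w)) v-w≡0)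
    in 0≢1+n (trans (sym (proj₁ (spread-supported 0 v w v-w≢0))) offset≡1)

  unique-pool : Unique pool
  unique-pool = SetoidUniqueProperties.++⁺ setoid
    (SetoidUniqueProperties.map⁺ (≡.setoid _) setoid pool-A-injective
      (PropUniqueProperties.cartesianProduct⁺ (PropUniqueProperties.allFin⁺ _) (PropUniqueProperties.allFin⁺ _)))
    (SetoidUniqueProperties.map⁺ (≡.setoid _) setoid pool-B-injective
      (PropUniqueProperties.cartesianProduct⁺ (PropUniqueProperties.allFin⁺ _) (unique-nonzeroFins _)))
    λ (x∈A , x∈B) →
      let a , _ , x≈A = ∈-map⁻ pool-A x∈A
          b , b∈ , x≈B = ∈-map⁻ pool-B x∈B
      in pool-A≉pool-B (∈-nonzeroFins⁻ (proj₂ (∈-cartesianProduct⁻ (allFin r) _ b∈))) (≈-trans (≈-sym x≈A) x≈B)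

  pool-sparse : ∀ {x} → x ∈ pool → Sparse ℓ x
  pool-sparse x∈ with ∈-++⁻ setoid (map pool-A pool-A-indices) x∈
  ... | inj₁ x∈A = let (c , v) , _ , x≈ = ∈-map⁻ pool-A x∈A in
    sparse-resp (≈-sym x≈) (supported⇒sparse {y = spread {ℓ} 0 v} (suc (toℕ c)) (spread-supported 0 v) ≤-refl)
  ... | inj₂ x∈B = let (c , u) , _ , x≈ = ∈-map⁻ pool-B x∈B in
    sparse-resp (≈-sym x≈) (supported⇒sparse {y = spread {m} 1 u} (toℕ c) (spread-supported 1 u) (<⇒≤ m<ℓ))

  ε∉pool : ε ∉ pool
  ε∉pool ε∈ with ∈-++⁻ setoid (map pool-A pool-A-indices) ε∈
  ... | inj₁ ε∈A = let (c , v) , _ , ε≈ = ∈-map⁻ pool-A ε∈A in shift≉ε (s≤s z≤n) (suc-toℕ<r c) (≈-sym ε≈)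
  ... | inj₂ ε∈B =
    let (c , u) , cu∈ , ε≈ = ∈-map⁻ pool-B ε∈B
        w , u-w≢0 = spread-nonzero second-cells u (∈-nonzeroFins⁻ (proj₂ (∈-cartesianProduct⁻ (allFin r) _ cu∈)))
    in u-w≢0 (sym (≈-coords ε≈ w))

  length-pool : length pool ≡ (2 + r₃) * t ^ ℓ + (3 + r₃) * T
  length-pool = begin
    length pool
      ≡⟨ length-++ (map pool-A pool-A-indices) ⟩
    length (map pool-A pool-A-indices) + length (map pool-B pool-B-indices)
      ≡⟨ cong₂ _+_ (trans (length-map pool-A pool-A-indices) (length-cartesianProduct (allFin (r ∸ 1)) codes))
                     (trans (length-map pool-B pool-B-indices) (length-cartesianProduct (allFin r) _)) ⟩
    length (allFin (r ∸ 1)) * length codes + length (allFin r) * length (nonzeroFins (t ^ m))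
      ≡⟨ cong₂ _+_ (cong₂ _*_ (length-tabulate {n = r ∸ 1} (λ i → i)) (length-tabulate {n = t ^ ℓ} (λ i → i)))
                     (cong₂ _*_ (length-tabulate {n = r} (λ i → i)) (length-nonzeroFins (t ^ m))) ⟩
    (r ∸ 1) * t ^ ℓ + r * T
      ≡⟨ cong (λ r′ → (r′ ∸ 1) * t ^ ℓ + r′ * T) r≡3+r₃ ⟩
    (2 + r₃) * t ^ ℓ + (3 + r₃) * T ∎
    where open ≡.≡-Reasoning

  D≤|pool| : D ≤ length pool
  D≤|pool| = begin
    D                                          ≡⟨ D≡ ⟩
    2 * N + (3 + 2 * r₃) * T + r₃              ≡⟨ cong (λ x → 2 * x + (3 + 2 * r₃) * T + r₃) N≡ ⟩
    2 * (suc T + e) + (3 + 2 * r₃) * T + r₃    ≤⟨ m≤m+n _ (r₃ * e) ⟩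
    2 * (suc T + e) + (3 + 2 * r₃) * T + r₃ + r₃ * e
      ≡⟨ solve 3 (λ T e r₃ → con 2 :* (con 1 :+ T :+ e) :+ (con 3 :+ con 2 :* r₃) :* T :+ r₃ :+ r₃ :* e
                           := (con 2 :+ r₃) :* (con 1 :+ T :+ e) :+ (con 3 :+ r₃) :* T) refl T e r₃ ⟩
    (2 + r₃) * (suc T + e) + (3 + r₃) * T      ≡⟨ cong (λ x → (2 + r₃) * x + (3 + r₃) * T) N≡ ⟨
    (2 + r₃) * N + (3 + r₃) * T                ≡⟨ length-pool ⟨
    length pool                                ∎
    where
    open ≤-Reasoning
    open +-*-Solver
    N = t ^ ℓ
    e = N ∸ t ^ m
    N≡ : N ≡ suc T + e
    N≡ = trans (sym (m+[n∸m]≡n (^-monoʳ-≤ t (<⇒≤ m<ℓ)))) (cong (_+ e) t^m≡1+T)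

  mask : ℕ → Coords → Coords
  mask j x w with offsetOf w ℕ.≟ j
  ... | yes _ = x w
  ... | no _  = 0

  maskBelow : ℕ → Coords → Coords
  maskBelow n x w with offsetOf w <? n
  ... | yes _ = x w
  ... | no _  = 0

  maskBelow-suc : ∀ n x w → maskBelow n x w + mask n x w ≡ maskBelow (suc n) x w
  maskBelow-suc n x w with offsetOf w <? n | offsetOf w ℕ.≟ n | offsetOf w <? suc n
  ... | yes o<n | yes o≡n | _       = ⊥-elim (<-irrefl o≡n o<n)
  ... | yes _   | no _    | yes _   = +-identityʳ (x w)
  ... | yes o<n | no _    | no o≮1+n = ⊥-elim (o≮1+n (≤-trans o<n (n≤1+n _)))
  ... | no _    | yes _   | yes _   = refl
  ... | no _    | yes o≡n | no o≮1+n = ⊥-elim (o≮1+n (s≤s (≤-reflexive o≡n)))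
  ... | no o≮n  | no o≢n  | yes o<1+n = ⊥-elim (o≮n (≤∧≢⇒< (ℕ.s≤s⁻¹ o<1+n) o≢n))
  ... | no _    | no _    | no _    = refl

  maskBelow-0 : ∀ x w → maskBelow 0 x w ≡ 0
  maskBelow-0 x w with offsetOf w <? 0
  ... | no _ = refl

  maskBelow-k : ∀ x w → maskBelow k x w ≡ x w
  maskBelow-k x w with offsetOf w <? k
  ... | yes _   = refl
  ... | no o≮k  = ⊥-elim (o≮k (offset<k (toℕ w)))

  -- k - 1 letters write the cells of offset below k - 1; one last generator does the rest.
  letter : Coords → ℕ → Element
  letter x j = r ∸ 1 , rot j (mask j x)

  letters : Coords → ℕ → List Element
  letters x zero    = []
  letters x (suc n) = letters x n ++ letter x n ∷ []

  length-letters : ∀ x n → length (letters x n) ≡ n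
  length-letters x zero    = refl
  length-letters x (suc n) = trans (length-++ (letters x n)) (trans (cong (_+ 1) (length-letters x n)) (+-comm n 1))

  rot-[r∸1]*j-rot-j : ∀ j y w → rot ((r ∸ 1) * j) (rot j y) w ≡ y w
  rot-[r∸1]*j-rot-j j y w = trans (rot-rot _ j y w)
    (rot-≡0 y (trans (cong (_% r) ([n∸1]*m+m≡n*m r j)) (trans (cong (_% r) (*-comm r j)) (m*n%n≡0 j r))) w)

  product-letters : ∀ x n → foldl _∙_ ε (letters x n) ≈ ((r ∸ 1) * n , maskBelow n x)
  product-letters x zero = cong (_% r) (sym (*-zeroʳ (r ∸ 1))) ,≈ λ w → cong (_% t) (sym (maskBelow-0 x w))
  product-letters x (suc n) = subst (_≈ ((r ∸ 1) * suc n , maskBelow (suc n) x))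
    (sym (foldl-++ _∙_ ε (letters x n) (letter x n ∷ [])))
    (≈-trans (∙-cong (product-letters x n) (≈-refl {letter x n}))
      (cong (_% r) (trans (+-comm _ (r ∸ 1)) (sym (*-suc (r ∸ 1) n))) ,≈ λ w →
       cong (_% t) (trans (cong (maskBelow n x w +_) (rot-[r∸1]*j-rot-j n (mask n x) w)) (maskBelow-suc n x w))))

  rot-mask-support : ∀ j x w → ¬ rot j (mask j x) w % t ≡ 0 →
                     offsetOf w ≡ 0 × rowOf w ≡ rowOf ((toℕ w + j) mod r) × offsetOf ((toℕ w + j) mod r) ≡ j
  rot-mask-support j x w y≢0 = offset≡0 , row≡ , offset-i≡j
    where
    i = (toℕ w + j) mod r
    offset-i≡j : offsetOf i ≡ j
    offset-i≡j with offsetOf i ℕ.≟ j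
    ... | yes o≡j = o≡j
    ... | no _    = ⊥-elim (y≢0 refl)
    q = rowOf i
    start-coords-q = start-coords q (row<ℓ (toℕ i) (toℕ<n i))
    start+j≡i : start q + j ≡ toℕ i
    start+j≡i = trans (cong (start q +_) (sym offset-i≡j)) (start-row+offset (toℕ i) (toℕ<n i))
    w≡start : toℕ w ≡ start q
    w≡start = %-injective-< (toℕ<n w) (proj₁ start-coords-q) (%-cancelʳ-+ (toℕ w) (start q) j
      (trans (sym (m%n%n≡m%n (toℕ w + j) r)) (trans (cong (_% r) (sym (toℕ-mod (toℕ w + j)))) (cong (_% r) (sym start+j≡i)))))
    offset≡0 : offsetOf w ≡ 0
    offset≡0 = trans (cong offset w≡start) (proj₂ (proj₂ start-coords-q))
    row≡ : rowOf w ≡ q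
    row≡ = trans (cong row w≡start) (proj₁ (proj₂ start-coords-q))

  letter-supported : ∀ j x → SupportedAt ℓ 0 (rot j (mask j x))
  letter-supported j x w y≢0 =
    let offset≡0 , row≡ , _ = rot-mask-support j x w y≢0
    in offset≡0 , subst (_< ℓ) (sym row≡) (row<ℓ _ (toℕ<n ((toℕ w + j) mod r)))

  last-letter-supported : ∀ x → SupportedAt m 0 (rot k₁ (mask k₁ x))
  last-letter-supported x w y≢0 =
    let offset≡0 , row≡ , offset≡k₁ = rot-mask-support k₁ x w y≢0
    in offset≡0 , subst (_< m) (sym row≡) (offset≡k₁⇒row<m _ offset≡k₁)

  lastLetter : Element → Element
  lastLetter (a , x) = a + k₁ , rot k₁ (mask k₁ x)

  letters-lastLetter : ∀ d → foldl _∙_ ε (letters (proj₂ d) k₁) ∙ lastLetter d ≈ d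
  letters-lastLetter (a , x) = ≈-trans (∙-cong (product-letters x k₁) (≈-refl {lastLetter (a , x)}))
    (shift≡ ,≈ λ w → cong (_% t) (begin
      maskBelow k₁ x w + rot ((r ∸ 1) * k₁) (rot k₁ (mask k₁ x)) w ≡⟨ cong (maskBelow k₁ x w +_) (rot-[r∸1]*j-rot-j k₁ (mask k₁ x) w) ⟩
      maskBelow k₁ x w + mask k₁ x w                               ≡⟨ maskBelow-suc k₁ x w ⟩
      maskBelow k x w                                              ≡⟨ maskBelow-k x w ⟩
      x w                                                          ∎))
    where
    open ≡.≡-Reasoning
    shift≡ : ((r ∸ 1) * k₁ + (a + k₁)) % r ≡ a % r
    shift≡ = begin
      ((r ∸ 1) * k₁ + (a + k₁)) % r  ≡⟨ cong (_% r) (trans (cong ((r ∸ 1) * k₁ +_) (+-comm a k₁)) (sym (+-assoc _ k₁ a))) ⟩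
      ((r ∸ 1) * k₁ + k₁ + a) % r    ≡⟨ cong (λ y → (y + a) % r) (trans ([n∸1]*m+m≡n*m r k₁) (*-comm r k₁)) ⟩
      (k₁ * r + a) % r               ≡⟨ cong (_% r) (+-comm (k₁ * r) a) ⟩
      (a + k₁ * r) % r               ≡⟨ [m+kn]%n≡m%n a k₁ r ⟩
      a % r                          ∎

  letter∈generators : ∀ x j → letter x j ∈ generators
  letter∈generators x j = ∈-generators⁺ (A-gen (code {ℓ} (λ q → y (cell (toℕ q) 0))))
    (refl ,≈ λ w → sym (spread-code {ℓ} {0} {y} (letter-supported j x) w))
    where y = rot j (mask j x)

  <r∧≢r∸1⇒≤r∸2 : ∀ {c} → c < r → c ≢ r ∸ 1 → c ≤ r ∸ 2
  <r∧≢r∸1⇒≤r∸2 {c} c<r c≢r∸1 = subst (c ≤_) (∸-+-assoc r 1 1)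
    (m+n≤o⇒m≤o∸n c (subst (_≤ r ∸ 1) (+-comm 1 c) (≤∧≢⇒< c≤r∸1 c≢r∸1)))
    where
    c≤r∸1 : c ≤ r ∸ 1
    c≤r∸1 = m+n≤o⇒m≤o∸n c (subst (_≤ r) (+-comm 1 c) c<r)

  v₀ : Fin (t ^ ℓ)
  v₀ = code {ℓ} (λ _ → 0)

  v₀≡0 : toℕ v₀ ≡ 0
  v₀≡0 = toℕ-funToFin≡0 {ℓ} {t} (λ _ → 0 mod t) (λ _ → refl)

  A⁻¹v₀≈1 : A⁻¹ v₀ ≈ (1 , λ _ → 0)
  A⁻¹v₀≈1 = trans ([n∸1]*m%n≡[n∸m]%n r 1≤r∸1 (m∸n≤m r 1)) (cong (_% r) (m∸[m∸n]≡n 0<r)) ,≈ λ w →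
    trans (%-cong-* {t} {t ∸ 1} {t ∸ 1} {rot ((r ∸ 1) * (r ∸ 1)) (spread {ℓ} 0 v₀) w} {0} refl
                    (spread-zero 0 v₀ v₀≡0 ((toℕ w + (r ∸ 1) * (r ∸ 1)) mod r)))
          (cong (_% t) (*-zeroʳ (t ∸ 1)))

  short≈ε⊎∈generators : ∀ {c y} → c ≤ r ∸ 2 → SupportedAt m 0 y → (c , y) ≈ ε ⊎ (c , y) ∈ generators
  short≈ε⊎∈generators {c} {y} c≤r∸2 y-supp with any? (λ w → ¬? (y w % t ℕ.≟ 0))
  ... | yes (w , y-w≢0) = inj₂ (∈-generators⁺ (L-gen c≤r∸2 u≢0) (refl ,≈ λ w → sym (spread-code {m} {0} {y} y-supp w)))
    where
    u = code {m} (λ q → y (cell (toℕ q) 0))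
    u≢0 : NonZeroCode u
    u≢0 u≡0 = y-w≢0 (trans (sym (spread-code {m} {0} {y} y-supp w)) (spread-zero 0 u u≡0 w))
  ... | no ∄ = zero-coords c c≤r∸2
    where
    y≋0 : ∀ w → y w % t ≡ 0
    y≋0 w = decidable-stable (y w % t ℕ.≟ 0) (λ y-w≢0 → ∄ (w , y-w≢0))
    zero-coords : ∀ c → c ≤ r ∸ 2 → (c , y) ≈ ε ⊎ (c , y) ∈ generators
    zero-coords zero          _      = inj₁ (refl ,≈ y≋0)
    zero-coords (suc zero)    _      = inj₂ (∈-generators⁺ (A⁻¹-gen v₀) (≈-trans (refl ,≈ y≋0) (≈-sym A⁻¹v₀≈1)))
    zero-coords (suc (suc c)) c≤r∸2 = inj₂ (∈-generators⁺ (Z-gen (s≤s (s≤s z≤n)) c≤r∸2) (refl ,≈ y≋0))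

  row-start-coords≈ε⊎∈generators : ∀ {c y} → c < r → SupportedAt m 0 y → (c , y) ≈ ε ⊎ (c , y) ∈ generators
  row-start-coords≈ε⊎∈generators {c} {y} c<r y-supp with c ℕ.≟ r ∸ 1
  ... | no c≢r∸1  = short≈ε⊎∈generators (<r∧≢r∸1⇒≤r∸2 c<r c≢r∸1) y-supp
  ... | yes c≡r∸1 = inj₂ (∈-generators⁺ (A-gen (code {ℓ} (λ q → y (cell (toℕ q) 0))))
                      (cong (_% r) c≡r∸1 ,≈ λ w → sym (spread-code {ℓ} {0} {y} y-supp′ w)))
    where
    y-supp′ : SupportedAt ℓ 0 y
    y-supp′ w y≢0 = let o≡0 , row<m = y-supp w y≢0 in o≡0 , <-trans row<m m<ℓ

  lastLetter≈ε⊎∈generators : ∀ d → lastLetter d ≈ ε ⊎ lastLetter d ∈ generators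
  lastLetter≈ε⊎∈generators (a , x) =
    Sum.map (≈-trans lastLetter≈) (∈-resp-≈ (setoid) (≈-sym lastLetter≈))
      (row-start-coords≈ε⊎∈generators {y = y} (m%n<n (a + k₁) r) (last-letter-supported x))
    where
    y = rot k₁ (mask k₁ x)
    lastLetter≈ : lastLetter (a , x) ≈ ((a + k₁) % r , y)
    lastLetter≈ = sym (m%n%n≡m%n (a + k₁) r) ,≈ λ _ → refl

  module _ {S} {S-distinct : Unique S} {ε∉S : ε ∉ S} {S-inv : ∀ {s} → s ∈ S → s ⁻¹ ∈ S}
           (generators⊆S : ∀ {x} → x ∈ generators → x ∈ S) where

    private
      Γ = cayleyGraph S S-distinct ε∉S S-inv
    open CayleyGraph Γ using (Path)
    open CayleyPaths Γ

    letters∈S : ∀ x n → All (_∈ S) (letters x n)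
    letters∈S x zero    = []
    letters∈S x (suc n) = AllProperties.++⁺ (letters∈S x n) (generators⊆S (letter∈generators x n) ∷ [])

    path≤k : ∀ g h → Path k g h
    path≤k g h = [ via-letters , via-letters-and-last ]′ (lastLetter≈ε⊎∈generators d)
      where
      d = g ⁻¹ ∙ h
      x = proj₂ d
      word = foldl _∙_ ε (letters x k₁)
      via-letters : lastLetter d ≈ ε → Path k g h
      via-letters last≈ε = path-mono (≤-trans (≤-reflexive (length-letters x k₁)) (n≤1+n k₁))
        (path-from-word (letters∈S x k₁) (begin
          word                  ≈⟨ identityʳ word ⟨
          word ∙ ε              ≈⟨ ∙-cong (≈-refl {word}) last≈ε ⟨
          word ∙ lastLetter d   ≈⟨ letters-lastLetter d ⟩
          d                     ∎))
        where open import Relation.Binary.Reasoning.Setoid setoid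
      via-letters-and-last : lastLetter d ∈ generators → Path k g h
      via-letters-and-last last∈ = subst (λ n → Path n g h) length≡k
        (path-from-word (AllProperties.++⁺ (letters∈S x k₁) (generators⊆S last∈ ∷ []))
          (subst (_≈ d) (sym (foldl-++ _∙_ ε (letters x k₁) (lastLetter d ∷ []))) (letters-lastLetter d)))
        where
        length≡k : length (letters x k₁ ++ lastLetter d ∷ []) ≡ k
        length≡k = trans (length-++ (letters x k₁)) (trans (cong (_+ 1) (length-letters x k₁)) (+-comm k₁ 1))

  p₁ : Fin r
  p₁ = cell 0 1

  cell-0-1 : Cell 0 1
  cell-0-1 = <-trans 1≤m m<ℓ , s≤s (s≤s z≤n) , inj₁ 1≤m

  offset-p₁ : offsetOf p₁ ≡ 1
  offset-p₁ = proj₂ (proj₂ (cell-coords cell-0-1))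

  toℕ-p₁ : toℕ p₁ ≡ 1
  toℕ-p₁ = trans (proj₁ (cell-coords cell-0-1)) (cong (_+ 1) start-0)
    where
    start-0 : start 0 ≡ 0
    start-0 with 0 ℕ.<? m
    ... | yes _  = refl
    ... | no 0≮m = ⊥-elim (0≮m 1≤m)

  spread-0-at-p₁ : ∀ {p} (u : Fin (t ^ p)) → spread {p} 0 u p₁ % t ≡ 0
  spread-0-at-p₁ u with spread 0 u p₁ % t ℕ.≟ 0
  ... | yes ≡0 = ≡0
  ... | no ≢0  = ⊥-elim (0≢1+n (trans (sym (proj₁ (spread-supported 0 u p₁ ≢0))) offset-p₁))

  -- For even t, (0 , h at p₁) with h = t / 2 is an involution outside the generators.
  module EvenT (h : ℕ) (t≡h+h : t ≡ h + h) where

    1≤h : 1 ≤ h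
    1≤h = n≢0⇒n>0 λ h≡0 → 0≢1+n (sym (trans t≡h+h (cong₂ _+_ h≡0 h≡0)))

    h<t : h < t
    h<t = subst (h <_) (sym t≡h+h) (m<m+n h 1≤h)

    e : Coords
    e w with w Fin.≟ p₁
    ... | yes _ = h
    ... | no _  = 0

    j : Element
    j = 0 , e

    j⁻¹≈j : j ⁻¹ ≈ j
    j⁻¹≈j = cong (_% r) (*-zeroʳ (r ∸ 1)) ,≈ λ w →
      trans (cong (λ v → ((t ∸ 1) * v) % t) (rot-≡0 e (trans (cong (_% r) (*-zeroʳ (r ∸ 1))) (0%n≡0 r)) w)) (-e≡e w)
      where
      -e≡e : ∀ w → ((t ∸ 1) * e w) % t ≡ e w % t
      -e≡e w with w Fin.≟ p₁
      ... | yes _ = trans ([n∸1]*m%n≡[n∸m]%n t 1≤h (<⇒≤ h<t)) (cong (_% t) (trans (cong (_∸ h) t≡h+h) (m+n∸n≡m h h)))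
      ... | no _  = cong (_% t) (*-zeroʳ (t ∸ 1))

    e-p₁ : e p₁ ≡ h
    e-p₁ with p₁ Fin.≟ p₁
    ... | yes _  = refl
    ... | no ≢p₁ = ⊥-elim (≢p₁ refl)

    h≢0 : ¬ h % t ≡ 0
    h≢0 h≡0 = <⇒≢ 1≤h (sym (trans (sym (m<n⇒m%n≡m h<t)) h≡0))

    j≉ε : ¬ j ≈ ε
    j≉ε j≈ε = h≢0 (trans (cong (_% t) (sym e-p₁)) (≈-coords j≈ε p₁))

    j-sparse : Sparse ℓ j
    j-sparse = (λ _ → p₁) , λ w 0≢e → Fin.fromℕ< (<-trans 1≤m m<ℓ) , sym (e≢0⇒p₁ w λ e≡0 → 0≢e (sym e≡0))
      where
      e≢0⇒p₁ : ∀ w → ¬ e w % t ≡ 0 → w ≡ p₁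
      e≢0⇒p₁ w e≢0 with w Fin.≟ p₁
      ... | yes w≡p₁ = w≡p₁
      ... | no _     = ⊥-elim (e≢0 refl)

    j≉generator : ∀ {g} → IsGenerator g → ¬ j ≈ g
    j≉generator (A-gen v)          (0≈ ,≈ _) = 0≉shift 1≤r∸1 r∸1<r 0≈
    j≉generator (A⁻¹-gen v)        (0≈ ,≈ _) = 0≉shift (s≤s z≤n) (≤-trans (s≤s (s≤s z≤n)) 3≤r) (trans 0≈ (≈-shift A⁻¹v₀≈1))
    j≉generator (L-gen {zero} {u} _ _) (_ ,≈ e≋) = h≢0 (trans (cong (_% t) (sym e-p₁)) (trans (e≋ p₁) (spread-0-at-p₁ u)))
    j≉generator (L-gen {suc c} c<r∸2 _) (0≈ ,≈ _) = 0≉shift (s≤s z≤n) (≤-<-trans c<r∸2 r∸2<r) 0≈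
    j≉generator (L⁻¹-gen 1≤c c≤r∸2 _) (0≈ ,≈ _) =
      let 2≤r∸c , r∸c<r = r∸c-bounds 1≤c c≤r∸2 in 0≉shift (≤-trans (s≤s z≤n) 2≤r∸c) r∸c<r (trans 0≈ ([r∸1]*c≈r∸c 1≤c c≤r∸2))
    j≉generator (Z-gen 2≤c c≤r∸2)  (0≈ ,≈ _) = 0≉shift (≤-trans (s≤s z≤n) 2≤c) (≤-<-trans c≤r∸2 r∸2<r) 0≈

    j∉generators : j ∉ generators
    j∉generators j∈ = let _ , g-gen , j≈g = ∈-generators⁻ j∈ in j≉generator g-gen j≈g

    repair : ParityRepair generators D
    repair = involution j j⁻¹≈j j≉ε j-sparse j∉generators

  -- For even r = 2H, (H , 1 at p₁ and -1 at p₁ + H) is an involution outside the generators.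
  module EvenR (H : ℕ) (r≡H+H : r ≡ H + H) where

    2≤H : 2 ≤ H
    2≤H = 3≤n+n⇒2≤n H (subst (3 ≤_) r≡H+H 3≤r)
      where
      3≤n+n⇒2≤n : ∀ n → 3 ≤ n + n → 2 ≤ n
      3≤n+n⇒2≤n (suc (suc _)) _ = s≤s (s≤s z≤n)
      3≤n+n⇒2≤n (suc zero) (s≤s (s≤s ()))

    H<r : H < r
    H<r = subst (H <_) (sym r≡H+H) (m<m+n H (≤-trans (s≤s z≤n) 2≤H))

    1+H<r : 1 + H < r
    1+H<r = subst (1 + H <_) (sym r≡H+H) (subst (_≤ H + H) (+-comm H 2) (+-monoʳ-≤ H 2≤H))

    σ : Fin r → Fin r
    σ w = (toℕ w + H) mod r

    [r∸1]*H≈H : ((r ∸ 1) * H) % r ≡ H % r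
    [r∸1]*H≈H = trans ([n∸1]*m%n≡[n∸m]%n r (≤-trans (s≤s z≤n) 2≤H) (<⇒≤ H<r))
                      (cong (_% r) (trans (cong (_∸ H) r≡H+H) (m+n∸n≡m H H)))

    σ-injective : ∀ {v w} → σ v ≡ σ w → v ≡ w
    σ-injective {v} {w} σv≡σw = toℕ-injective (%-injective-< (toℕ<n v) (toℕ<n w)
      (%-cancelʳ-+ (toℕ v) (toℕ w) H (trans (sym (toℕ-mod _)) (trans (cong toℕ σv≡σw) (toℕ-mod _)))))

    p₂ : Fin r
    p₂ = σ p₁

    σp₂≡p₁ : σ p₂ ≡ p₁
    σp₂≡p₁ = begin
      (toℕ ((toℕ p₁ + H) mod r) + H) mod r  ≡⟨ mod-+ (toℕ p₁ + H) H ⟩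
      (toℕ p₁ + H + H) mod r               ≡⟨ cong (_mod r) (trans (+-assoc (toℕ p₁) H H) (cong (toℕ p₁ +_) (sym r≡H+H))) ⟩
      (toℕ p₁ + r) mod r                   ≡⟨ mod-cong (trans ([m+n]%n≡m%n (toℕ p₁) r) refl) ⟩
      toℕ p₁ mod r                         ≡⟨ toℕ-mod-id p₁ ⟩
      p₁                                   ∎
      where open ≡.≡-Reasoning

    p₁≢p₂ : p₁ ≢ p₂
    p₁≢p₂ p₁≡p₂ = <⇒≢ (s≤s (≤-trans (s≤s z≤n) 2≤H)) (trans (sym toℕ-p₁) (trans (cong toℕ p₁≡p₂)
      (trans (toℕ-mod _) (trans (cong (λ i → (i + H) % r) toℕ-p₁) (m<n⇒m%n≡m 1+H<r)))))

    e : Coords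
    e w with w Fin.≟ p₁ | w Fin.≟ p₂
    ... | yes _ | _     = 1
    ... | no _  | yes _ = t ∸ 1
    ... | no _  | no _  = 0

    e-p₁ : e p₁ ≡ 1
    e-p₁ with p₁ Fin.≟ p₁
    ... | yes _  = refl
    ... | no ≢p₁ = ⊥-elim (≢p₁ refl)

    e-p₂ : e p₂ ≡ t ∸ 1
    e-p₂ with p₂ Fin.≟ p₁ | p₂ Fin.≟ p₂
    ... | yes p₂≡p₁ | _      = ⊥-elim (p₁≢p₂ (sym p₂≡p₁))
    ... | no _      | yes _  = refl
    ... | no _      | no ≢p₂ = ⊥-elim (≢p₂ refl)

    e-other : ∀ w → w ≢ p₁ → w ≢ p₂ → e w ≡ 0
    e-other w w≢p₁ w≢p₂ with w Fin.≟ p₁ | w Fin.≟ p₂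
    ... | yes w≡p₁ | _        = ⊥-elim (w≢p₁ w≡p₁)
    ... | no _     | yes w≡p₂ = ⊥-elim (w≢p₂ w≡p₂)
    ... | no _     | no _     = refl

    j : Element
    j = H , e

    trichotomy : ∀ w → w ≡ p₁ ⊎ w ≡ p₂ ⊎ (w ≢ p₁ × w ≢ p₂)
    trichotomy w with w Fin.≟ p₁ | w Fin.≟ p₂
    ... | yes w≡p₁ | _        = inj₁ w≡p₁
    ... | no _     | yes w≡p₂ = inj₂ (inj₁ w≡p₂)
    ... | no w≢p₁  | no w≢p₂  = inj₂ (inj₂ (w≢p₁ , w≢p₂))

    rot-[r∸1]*H : ∀ y w → rot ((r ∸ 1) * H) y w ≡ y (σ w)
    rot-[r∸1]*H y w = rot-cong y [r∸1]*H≈H w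

    j⁻¹≈j : j ⁻¹ ≈ j
    j⁻¹≈j = [r∸1]*H≈H ,≈ λ w → trans (cong (λ v → ((t ∸ 1) * v) % t) (rot-[r∸1]*H e w)) (-eσ≡e w)
      where
      -eσ≡e : ∀ w → ((t ∸ 1) * e (σ w)) % t ≡ e w % t
      -eσ≡e w with trichotomy w
      ... | inj₁ w≡p₁ = subst (λ v → ((t ∸ 1) * e (σ v)) % t ≡ e v % t) (sym w≡p₁)
        (trans (cong (λ v → ((t ∸ 1) * v) % t) e-p₂) (trans [t∸1]*[t∸1]≈1 (cong (_% t) (sym e-p₁))))
        where
        [t∸1]*[t∸1]≈1 : ((t ∸ 1) * (t ∸ 1)) % t ≡ 1 % t
        [t∸1]*[t∸1]≈1 = trans ([n∸1]*m%n≡[n∸m]%n t (s≤s z≤n) (n≤1+n (t ∸ 1))) (cong (_% t) (m∸[m∸n]≡n {t} {1} (s≤s z≤n)))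
      ... | inj₂ (inj₁ w≡p₂) = subst (λ v → ((t ∸ 1) * e (σ v)) % t ≡ e v % t) (sym w≡p₂)
        (cong (_% t) (trans (cong ((t ∸ 1) *_) (trans (cong e σp₂≡p₁) e-p₁)) (trans (*-identityʳ (t ∸ 1)) (sym e-p₂))))
      ... | inj₂ (inj₂ (w≢p₁ , w≢p₂)) =
        cong (_% t) (trans (cong ((t ∸ 1) *_) e-σw≡0) (trans (*-zeroʳ (t ∸ 1)) (sym (e-other w w≢p₁ w≢p₂))))
        where
        e-σw≡0 : e (σ w) ≡ 0
        e-σw≡0 = e-other (σ w) (λ σw≡p₁ → w≢p₂ (σ-injective (trans σw≡p₁ (sym σp₂≡p₁))))
                               (λ σw≡p₂ → w≢p₁ (σ-injective σw≡p₂))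

    1≉0 : ¬ e p₁ % t ≡ 0
    1≉0 e-p₁≡0 with () ← trans (cong (_% t) (sym e-p₁)) e-p₁≡0

    j≉ε : ¬ j ≈ ε
    j≉ε j≈ε = 1≉0 (≈-coords j≈ε p₁)

    j-sparse : Sparse ℓ j
    j-sparse = F , covers
      where
      F : Fin ℓ → Fin r
      F q = (1 + toℕ q * H) mod r
      0<ℓ : 0 < ℓ
      0<ℓ = <-trans 1≤m m<ℓ
      1<ℓ : 1 < ℓ
      1<ℓ = ≤-trans (s≤s 1≤m) m<ℓ
      F0≡p₁ : F (Fin.fromℕ< 0<ℓ) ≡ p₁
      F0≡p₁ = trans (cong (λ i → (1 + i * H) mod r) (toℕ-fromℕ< 0<ℓ)) (trans (cong (_mod r) (sym toℕ-p₁)) (toℕ-mod-id p₁))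
      F1≡p₂ : F (Fin.fromℕ< 1<ℓ) ≡ p₂
      F1≡p₂ = cong (_mod r) (trans (cong (λ i → 1 + i * H) (toℕ-fromℕ< 1<ℓ)) (cong₂ _+_ (sym toℕ-p₁) (+-identityʳ H)))
      covers : Covers F (λ _ → 0) e
      covers w 0≢e with trichotomy w
      ... | inj₁ w≡p₁              = Fin.fromℕ< 0<ℓ , trans F0≡p₁ (sym w≡p₁)
      ... | inj₂ (inj₁ w≡p₂)       = Fin.fromℕ< 1<ℓ , trans F1≡p₂ (sym w≡p₂)
      ... | inj₂ (inj₂ (w≢p₁ , w≢p₂)) = ⊥-elim (0≢e (cong (_% t) (sym (e-other w w≢p₁ w≢p₂))))

    e-p₂≢0 : ¬ e p₂ % t ≡ 0
    e-p₂≢0 e-p₂≡0 = 0≢1+n (sym (trans (sym (m<n⇒m%n≡m (n<1+n (t ∸ 1)))) (trans (cong (_% t) (sym e-p₂)) e-p₂≡0)))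

    j≉generator : ∀ {g} → IsGenerator g → ¬ j ≈ g
    j≉generator (A-gen v) (H≈ ,≈ _) = <⇒≢ (≤-trans (s≤s (s≤s z≤n)) 2≤H) (+-cancelʳ-≡ H 1 H (begin
      1 + H        ≡⟨ cong suc H≡r∸1 ⟩
      suc (r ∸ 1)  ≡⟨ m+[n∸m]≡n 0<r ⟩
      r            ≡⟨ r≡H+H ⟩
      H + H        ∎))
      where
      open ≡.≡-Reasoning
      H≡r∸1 : H ≡ r ∸ 1
      H≡r∸1 = %-injective-< H<r r∸1<r H≈
    j≉generator (A⁻¹-gen v) (H≈ ,≈ _) =
      <⇒≢ (≤-trans (s≤s (s≤s z≤n)) 2≤H) (sym (%-injective-< H<r (≤-trans (s≤s (s≤s z≤n)) 3≤r) (trans H≈ (≈-shift A⁻¹v₀≈1))))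
    j≉generator (L-gen {u = u} _ _) (_ ,≈ e≋) = 1≉0 (trans (e≋ p₁) (spread-0-at-p₁ u))
    j≉generator (L⁻¹-gen {c} {u} _ _ _) (H≈ ,≈ e≋) = e-p₂≢0 (trans (e≋ p₂) (begin
      ((t ∸ 1) * rot ((r ∸ 1) * c) (spread 0 u) p₂) % t ≡⟨ cong (λ v → ((t ∸ 1) * spread 0 u v) % t) σp₂≡ ⟩
      ((t ∸ 1) * spread 0 u p₁) % t                     ≡⟨ %-cong-* {t} {t ∸ 1} {t ∸ 1} {spread 0 u p₁} {0} refl (spread-0-at-p₁ u) ⟩
      ((t ∸ 1) * 0) % t                                 ≡⟨ cong (_% t) (*-zeroʳ (t ∸ 1)) ⟩
      0                                                 ∎))
      where
      open ≡.≡-Reasoning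
      σp₂≡ : (toℕ p₂ + (r ∸ 1) * c) mod r ≡ p₁
      σp₂≡ = trans (mod-cong (%-cong-+ {a = toℕ p₂} refl (sym H≈))) σp₂≡p₁
    j≉generator (Z-gen _ _) (_ ,≈ e≋) = 1≉0 (e≋ p₁)

    j∉generators : j ∉ generators
    j∉generators j∈ = let _ , g-gen , j≈g = ∈-generators⁻ j∈ in j≉generator g-gen j≈g

    repair : ParityRepair generators D
    repair = involution j j⁻¹≈j j≉ε j-sparse j∉generators

  module OddRT (2∤r : ¬ 2 ∣ r) (2∤t : ¬ 2 ∣ t) where

    no-involution : NoInvolution
    no-involution (a , y) g⁻¹≈g = trans a≈0 (sym (0%n≡0 r)) ,≈ λ w →
      [n∸1]*m%n≡m%n⇒m%n≡0 t 2∤t (y w) (trans (cong (λ v → ((t ∸ 1) * v) % t) (sym (rot-≡0 y [r∸1]*a≈0 w))) (≈-coords g⁻¹≈g w))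
      where
      a≈0 : a % r ≡ 0
      a≈0 = [n∸1]*m%n≡m%n⇒m%n≡0 r 2∤r a (≈-shift g⁻¹≈g)
      [r∸1]*a≈0 : ((r ∸ 1) * a) % r ≡ 0
      [r∸1]*a≈0 = trans (%-cong-* {r} {r ∸ 1} {r ∸ 1} {a} {0} refl (trans a≈0 (sym (0%n≡0 r))))
                        (trans (cong (_% r) (*-zeroʳ (r ∸ 1))) (0%n≡0 r))

    2∣D : 2 ∣ D
    2∣D = subst (2 ∣_) (sym D≡) (∣m∣n⇒∣m+n (∣m∣n⇒∣m+n (divides (t ^ ℓ) (*-comm 2 (t ^ ℓ))) (∣n⇒∣m*n (3 + 2 * r₃) 2∣T)) 2∣r₃)
      where
      2∣T : 2 ∣ T
      2∣T = 2∤1+n⇒2∣n (subst (λ n → ¬ 2 ∣ n) t^m≡1+T (2∤m⇒2∤m^n 2∤t m))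
      2∣r₃ : 2 ∣ r₃
      2∣r₃ = ∣m+n∣m⇒∣n (2∤1+n⇒2∣n (subst (λ n → ¬ 2 ∣ n) r≡3+r₃ 2∤r)) n∣n

    repair : ParityRepair generators D
    repair = involution-free no-involution 2∣D

  repair : ParityRepair generators D
  repair with 2 ∣? t | 2 ∣? r
  ... | yes 2∣t | _       = let h , t≡h+h = 2∣⇒≡h+h 2∣t in EvenT.repair h t≡h+h
  ... | no _    | yes 2∣r = let H , r≡H+H = 2∣⇒≡h+h 2∣r in EvenR.repair H r≡H+H
  ... | no 2∤t  | no 2∤r  = OddRT.repair 2∤r 2∤t

  cayleyGraph-of-degree-D : ∃[ Γ ] CayleyGraph.HasDiameter Γ k × CayleyGraph.degree Γ ≡ D × CayleyGraph.HasOrder Γ (r * t ^ r)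
  cayleyGraph-of-degree-D =
    cayleyGraph S (unique conn) (ε∉ conn) (⁻¹-closed conn) ,
    (path≤k generators⊆S , ε , (0 , λ _ → 1) , ¬path-ε-ones (sat conn) (s≤s (s≤s z≤n)) k₁ (m<m+n (k₁ * ℓ) 1≤m)) ,
    |S|≡D , order
    where
    open IsConnectionSet
    padded = padding unique-pool pool-sparse ε∉pool D≤|pool| repair
                     generators-⁻¹-closed generators-sparse ε∉generators (≤-reflexive (trans length-generators (sym D≡)))
    S = proj₁ padded
    conn = proj₁ (proj₂ padded)
    |S|≡D = proj₁ (proj₂ (proj₂ padded))
    generators⊆S = proj₂ (proj₂ (proj₂ padded))

theorem5 : (k ℓ t m : ℕ) → 2 ≤ k → 2 ≤ ℓ → 2 ≤ t → 1 ≤ m → m < ℓ →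
    let r = (k ∸ 1) * ℓ + m in
    ∃[ Γ ] (CayleyGraph.HasDiameter Γ k
      × CayleyGraph.degree Γ ≡ 2 * t ^ ℓ + (2 * r ∸ 3) * t ^ m ∸ r
      × CayleyGraph.HasOrder Γ (r * t ^ r))
theorem5 (suc (suc k₂)) ℓ (suc (suc t₂)) m (s≤s (s≤s _)) _ (s≤s (s≤s _)) 1≤m m<ℓ =
  Construction.cayleyGraph-of-degree-D k₂ ℓ m t₂ 1≤m m<ℓ
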